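{- Let $G$ be a simple graph, let $\mathcal{T}(G)$ be any output of the Star-Expansion algorithm applied to $G$, and let $L(\mathcal{T}(G))$ be the multiset of labels of the leaves (childless nodes) of $\mathcal{T}(G)$. Then every $H\in L(\mathcal{T}(G))$ is a disjoint union of stars and $$X_G=\sum_{H\in L(\mathcal{T}(G))}(-1)^{\iota(H)-\iota(G)}\,\mathfrak{st}_{\lambda(H)}.$$ Moreover, no cancellations occur: for every partition $\lambda$, all terms $\mathfrak{st}_\lambda$ in this sum appear with the same sign.
   Context: For a simple graph $G$ with vertices $v_1,\dots,v_n$, the chromatic symmetric function is $X_G=\sum_\kappa x_{\kappa(v_1)}\cdots x_{\kappa(v_n)}$ over all proper colorings $\kappa:V(G)\to\{1,2,\dots\}$ (adjacent vertices get different colors), $x_1,x_2,\dots$ commuting indeterminates. $St_k$ denotes the star graph on $k$ vertices (one vertex adjacent to all other $k-1$ vertices, no other edges; $St_1$ is a single vertex, $St_2$ a single edge). Set $\mathfrak{st}_k=X_{St_k}$ and, for a partition $\lambda=(\lambda_1,\dots,\lambda_l)$, $\mathfrak{st}_\lambda=\mathfrak{st}_{\lambda_1}\cdots\mathfrak{st}_{\lambda_l}$. For a graph $H$, $\iota(H)$ is the number of isolated vertices of $H$; if $H$ is a disjoint union of stars, $\lambda(H)$ is the partition whose parts are the numbers of vertices of its connected components. An edge is internal if it is not a loop and both its endpoints have degree greater than $1$. For a graph $H$, $H^s$ is obtained by deleting loops and replacing each class of parallel edges by one edge. For a non-loop edge $e=uv$ of $H$, $H\odot e$ is obtained by contracting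 $e$ (delete $e$, merge $u,v$ into a new vertex $v'$ which inherits all other edges incident with $u$ or $v$) and then adding a new vertex $v''$ and a new edge $\ell_e=v'v''$; $(H\odot e)^s\setminus \ell_e$ is $(H\odot e)^s$ with the edge $\ell_e$ deleted. The Star-Expansion algorithm on input a simple graph $G$ builds a rooted tree $\mathcal{T}$ whose nodes are labeled by simple graphs and whose edges are labeled $+$ or $-$: initially $\mathcal{T}$ is a single root labeled $G$. While some childless node labeled $H$ has an internal edge, choose such a node and such an internal edge $e$ of $H$ (arbitrarily) and attach to it three children labeled $H\setminus e$ (edge label $+$), $(H\odot e)^s$ (edge label $+$) and $(H\odot e)^s\setminus\ell_e$ (edge label $-$). The algorithm stops when no childless node has a label with an internal edge, and outputs $\mathcal{T}(G)=\mathcal{T}$. -}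

module Defs where

open import Data.Bool using (Bool; true; false; _∧_; _∨_; not; if_then_else_)
open import Data.Nat using (ℕ; zero; suc; _<_; _∸_; _<ᵇ_; _≡ᵇ_)
open import Data.Nat.Properties using ()
open import Data.Fin using (Fin; zero; suc; toℕ)
open import Data.Fin.Properties using (_≟_)
open import Data.List using (List; []; _∷_; _++_; map; length; concatMap; allFin; lookup; upTo; zipWith; foldr)
open import Data.Integer using (ℤ; +_; _*_; _+_; -_; ∣_∣) renaming (_-_ to _-ℤ_)
open import Data.Product using (Σ; _×_; _,_; ∃)
open import Data.Sum using (_⊎_)
open import Relation.Nullary using (¬_)
open import Relation.Nullary.Decidable using (⌊_⌋)
open import Relation.Binary.PropositionalEquality using (_≡_; _≢_)
open import Function.Bundles using (_⇔_)

-- A Bool-valued relation R is read as the simple graph whose edges are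
-- the unordered pairs {x,y}, x ≠ y, with R x y or R y x (symmetrised,
-- loops ignored).  Every simple graph on Fin n arises this way.

filterᵇ : {A : Set} → (A → Bool) → List A → List A
filterᵇ p [] = []
filterᵇ p (x ∷ xs) = if p x then x ∷ filterᵇ p xs else filterᵇ p xs

any : {A : Set} → (A → Bool) → List A → Bool
any p = foldr (λ x b → p x ∨ b) false

all : {A : Set} → (A → Bool) → List A → Bool
all p = foldr (λ x b → p x ∧ b) true

Graph : ℕ → Set
Graph n = Fin n → Fin n → Bool

_==_ : ∀ {n} → Fin n → Fin n → Bool
x == y = ⌊ x ≟ y ⌋

adj : ∀ {n} → Graph n → Fin n → Fin n → Bool
adj H x y = not (x == y) ∧ (H x y ∨ H y x)

count : ∀ {n} → (Fin n → Bool) → ℕ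
count {n} p = length (filterᵇ p (allFin n))

deg : ∀ {n} → Graph n → Fin n → ℕ
deg H x = count (adj H x)

iota : ∀ {n} → Graph n → ℕ
iota H = count (λ x → deg H x ≡ᵇ 0)

Internal : ∀ {n} → Graph n → Fin n → Fin n → Set
Internal H u v = (adj H u v ≡ true) × (1 < deg H u) × (1 < deg H v)

isPair : ∀ {n} → Fin n → Fin n → Fin n → Fin n → Bool
isPair u v x y = (x == u ∧ y == v) ∨ (x == v ∧ y == u)

delEdge : ∀ {n} → Graph n → Fin n → Fin n → Graph n
delEdge H u v x y = adj H x y ∧ not (isPair u v x y)

-- (H ⊙ e)^s, with e = uv: the merged vertex v' gets the name u and the
-- new pendant vertex v'' gets the name v (the old v disappears);
-- `withL` says whether the edge ℓ_e = v'v'' is present.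
odotGen : ∀ {n} → Bool → Graph n → Fin n → Fin n → Graph n
odotGen withL H u v x y =
  if (x == v ∨ y == v) then (withL ∧ isPair u v x y)
  else (if x == u then (adj H u y ∨ adj H v y)
  else (if y == u then (adj H x u ∨ adj H x v)
  else adj H x y))

odot : ∀ {n} → Graph n → Fin n → Fin n → Graph n
odot = odotGen true

odotMinus : ∀ {n} → Graph n → Fin n → Fin n → Graph n
odotMinus = odotGen false

-- Possible outputs of the Star-Expansion algorithm started at a node
-- labelled H: finite rooted trees in which every internal node labelled H
-- has been expanded along some internal edge e = uv of H into the three
-- children H∖e (+), (H⊙e)^s (+), (H⊙e)^s∖ℓ_e (−), and every leaf has
-- a label without internal edges.

data ExpTree {n : ℕ} : Graph n → Set where
  leaf : {H : Graph n} → (∀ u v → ¬ Internal H u v) → ExpTree H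
  node : {H : Graph n} (u v : Fin n) → Internal H u v →
         ExpTree (delEdge H u v) → ExpTree (odot H u v) →
         ExpTree (odotMinus H u v) → ExpTree H

leaves : ∀ {n} {H : Graph n} → ExpTree H → List (Graph n)
leaves {H = H} (leaf _) = H ∷ []
leaves (node u v _ t₁ t₂ t₃) = leaves t₁ ++ leaves t₂ ++ leaves t₃

reach : ∀ {n} → Graph n → ℕ → Fin n → Fin n → Bool
reach H zero x y = x == y
reach H (suc k) x y = reach H k x y ∨ any (λ z → reach H k x z ∧ adj H z y) (allFin _)

conn : ∀ {n} → Graph n → Fin n → Fin n → Bool
conn {n} H = reach H n

IsStarForest : ∀ {n} → Graph n → Set
IsStarForest {n} H = ∀ (x : Fin n) → Σ (Fin n) λ c → (conn H x c ≡ true) ×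
  (∀ y z → conn H x y ≡ true → conn H x z ≡ true → y ≢ z →
     (adj H y z ≡ true) ⇔ ((y ≡ c) ⊎ (z ≡ c)))

-- λ(H): list of sizes of connected components (one entry per component,
-- namely for its least vertex); a partition up to reordering.
lam : ∀ {n} → Graph n → List ℕ
lam {n} H = map (λ x → count (conn H x)) (filterᵇ isRep (allFin n))
  where
  isRep : Fin n → Bool
  isRep x = not (any (λ y → (toℕ y <ᵇ toℕ x) ∧ conn H x y) (allFin n))

-- Formal power series in x₁, x₂, … with integer coefficients, given by
-- their coefficient function: a monomial x₁^{α₀} x₂^{α₁} ⋯ is a list α
-- of exponents (trailing entries beyond the list are 0).

Series : Set
Series = List ℕ → ℤ

funs : (n m : ℕ) → List (Fin n → Fin m)
funs zero m = (λ ()) ∷ []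
funs (suc n) m = concatMap (λ c → map (λ f → cons c f) (funs n m)) (allFin m)
  where
  cons : ∀ {n} → Fin m → (Fin n → Fin m) → Fin (suc n) → Fin m
  cons c f zero = c
  cons c f (suc i) = f i

proper : ∀ {n m} → Graph n → (Fin n → Fin m) → Bool
proper {n} H κ = all (λ x → all (λ y → not (adj H x y) ∨ not (κ x == κ y)) (allFin n)) (allFin n)

hasContent : ∀ {n} (α : List ℕ) → (Fin n → Fin (length α)) → Bool
hasContent α κ = all (λ i → count (λ x → κ x == i) ≡ᵇ lookup α i) (allFin (length α))

-- X_H: coefficient of x^α = number of proper colourings κ with monomial x^α
-- (such colourings only use colours 1..length α)
X : ∀ {n} → Graph n → Series
X {n} H α = + length (filterᵇ (λ κ → proper H κ ∧ hasContent α κ) (funs n (length α)))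

oneS : Series
oneS α = if all (λ a → a ≡ᵇ 0) α then + 1 else + 0

below : List ℕ → List (List ℕ)
below [] = [] ∷ []
below (a ∷ as) = concatMap (λ b → map (b ∷_) (below as)) (upTo (suc a))

sumℤ : List ℤ → ℤ
sumℤ = foldr _+_ (+ 0)

mulS : Series → Series → Series
mulS f g α = sumℤ (map (λ β → f β * g (zipWith _∸_ α β)) (below α))

starGraph : (k : ℕ) → Graph k
starGraph k x y = (toℕ x ≡ᵇ 0) ∨ (toℕ y ≡ᵇ 0)

st : ℕ → Series
st k = X (starGraph k)

stλ : List ℕ → Series
stλ [] = oneS
stλ (k ∷ ks) = mulS (st k) (stλ ks)

negOnePow : ℤ → ℤ
negOnePow z = if (∣ z ∣ Data.Nat.% 2) ≡ᵇ 0 then + 1 else - (+ 1)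
  where import Data.Nat

sgn : ∀ {n} → Graph n → Graph n → ℤ
sgn G H = negOnePow (+ iota H -ℤ + iota G)

{-# OPTIONS --safe #-}
-- Each expansion step is a form of deletion–contraction. The proper colourings of H are those of
-- H ∖ e (e = uv) giving u and v different colours; those giving them equal colours are the
-- equal-colour proper colourings of (H⊙e)^s∖ℓ_e (v merged into u, then detached), and (H⊙e)^s keeps
-- exactly the different-colour ones of (H⊙e)^s∖ℓ_e. Hence X_H = X_{H∖e} + X_{(H⊙e)^s} − X_{(H⊙e)^s∖ℓ_e},
-- and only the last child gains an isolated vertex (v), which accounts for the sign. A leaf has no
-- internal edge, so each of its components has diameter at most two and is a star; X is multiplicative
-- over components and invariant under isomorphism, so X of a leaf H is st_{λ(H)}. Finally ι(H) of a
-- star forest is the number of parts of λ(H) equal to 1, so the sign of a leaf depends only on λ(H).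
module Submission where

open import Defs

open import Data.Bool using (Bool; true; false; _∧_; _∨_; not; if_then_else_; T)
open import Data.Bool.Properties using (∧-zeroʳ; ∧-identityʳ; ∨-comm; ¬-not)
open import Data.Empty using (⊥; ⊥-elim)
open import Data.Fin using (Fin; zero; suc; toℕ)
open import Data.Fin.Properties using (_≟_; toℕ-injective)
import Data.Fin.Properties as Fin
import Data.Fin.Permutation.Components as PC
open import Data.Integer using (ℤ; ∣_∣; _⊖_) renaming (_+_ to _+ℤ_; _*_ to _*ℤ_; _-_ to _-ℤ_)
import Data.Integer as ℤ
open import Data.Integer.Properties
  using (pos-+; pos-*; neg-involutive; [1+m]⊖[1+n]≡m⊖n; [+m]-[+n]≡m⊖n; n⊖n≡0; neg-distrib-+; neg-distribˡ-*)
  renaming (+-identityˡ to +-identityˡ-ℤ; +-identityʳ to +-identityʳ-ℤ; *-identityˡ to *-identityˡ-ℤ; +-assoc to +-assoc-ℤ)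
open import Data.Integer.Tactic.RingSolver using (solve-∀)
open import Data.List using (List; []; _∷_; _++_; map; length; concatMap; allFin; tabulate; upTo; zipWith; lookup; _∷ʳ_)
open import Data.List.Properties using (tabulate-cong; length-tabulate; upTo-∷ʳ)
open import Data.List.Membership.Propositional using (_∈_)
open import Data.List.Relation.Binary.Permutation.Propositional using (_↭_)
import Data.List.Relation.Binary.Permutation.Propositional as ↭
open import Data.List.Relation.Unary.All using (All; []; _∷_; universal)
import Data.List.Relation.Unary.All as All
open import Data.List.Relation.Unary.All.Properties using (map⁺; concat⁺; ++⁺)
open import Data.List.Relation.Unary.AllPairs using (AllPairs; []; _∷_)
open import Data.List.Relation.Unary.Unique.Propositional.Properties using (allFin⁺)
open import Data.Nat using (ℕ; zero; suc; _+_; _*_; _∸_; _%_; _≤_; _<_; z≤n; s≤s; _≡ᵇ_; _<ᵇ_; _≤′_; ≤′-reflexive; ≤′-step)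
open import Data.Nat.DivMod using ([m+n]%n≡m%n)
open import Data.Nat.Properties
  using (+-assoc; +-comm; +-suc; +-identityʳ; *-distribˡ-+; *-zeroʳ; *-identityˡ; *-identityʳ; *-comm; *-assoc;
         ≤-trans; m≤n+m; 1+n≰n; <-irrefl; <-cmp; suc-injective; ≡ᵇ⇒≡; <⇒<ᵇ; <ᵇ⇒<; ≤⇒≤′)
open import Data.Product using (Σ; _×_; _,_; proj₁; proj₂)
open import Data.Sum using (_⊎_; inj₁; inj₂; [_,_]′)
open import Data.Unit using (tt)
open import Function.Bundles using (mk⇔)
open import Relation.Binary using (tri<; tri≈; tri>)
open import Relation.Binary.PropositionalEquality using (_≡_; _≢_; refl; sym; trans; cong; cong₂; subst; module ≡-Reasoning)
open import Relation.Nullary using (¬_; yes; no)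
open import Relation.Nullary.Decidable using (dec-true; toSum)

bit : Bool → ℕ
bit true = 1
bit false = 0

bit-∧ : ∀ a b → bit (a ∧ b) ≡ bit a * bit b
bit-∧ true b = sym (+-identityʳ (bit b))
bit-∧ false b = refl

true≢false : ∀ {a : Bool} → a ≡ true → a ≡ false → ⊥
true≢false refl ()

≡true-⇔ : ∀ {a b : Bool} → (a ≡ true → b ≡ true) → (b ≡ true → a ≡ true) → a ≡ b
≡true-⇔ {true} {true} f g = refl
≡true-⇔ {true} {false} f g = sym (f refl)
≡true-⇔ {false} {true} f g = g refl
≡true-⇔ {false} {false} f g = refl

∧-intro : ∀ {a b : Bool} → a ≡ true → b ≡ true → (a ∧ b) ≡ true
∧-intro refl refl = refl

∧-elimˡ : ∀ {a b : Bool} → (a ∧ b) ≡ true → a ≡ true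
∧-elimˡ {true} _ = refl

∧-elimʳ : ∀ {a b : Bool} → (a ∧ b) ≡ true → b ≡ true
∧-elimʳ {true} p = p

∨-elim : ∀ {a b : Bool} → (a ∨ b) ≡ true → (a ≡ true) ⊎ (b ≡ true)
∨-elim {true} p = inj₁ refl
∨-elim {false} p = inj₂ p

∨-introˡ : ∀ {a b : Bool} → a ≡ true → (a ∨ b) ≡ true
∨-introˡ refl = refl

∨-introʳ : ∀ {a b : Bool} → b ≡ true → (a ∨ b) ≡ true
∨-introʳ {true} p = refl
∨-introʳ {false} p = p

∨-falseˡ : ∀ {a b : Bool} → (a ∨ b) ≡ false → a ≡ false
∨-falseˡ {false} e = refl

∨-falseʳ : ∀ {a b : Bool} → (a ∨ b) ≡ false → b ≡ false
∨-falseʳ {false} e = e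

not-true : ∀ {a : Bool} → not a ≡ true → a ≡ false
not-true {false} _ = refl

not-false : ∀ {a : Bool} → a ≡ false → not a ≡ true
not-false refl = refl

nand⇒ : ∀ (a b : Bool) → (not a ∨ not b) ≡ true → a ≡ true → b ≡ false
nand⇒ true true () refl
nand⇒ true false e refl = refl

⇒nand : ∀ (a b : Bool) → (a ≡ true → b ≡ false) → (not a ∨ not b) ≡ true
⇒nand true true f with f refl
... | ()
⇒nand true false f = refl
⇒nand false b f = refl

if-true : ∀ {A : Set} {b : Bool} (x y : A) → b ≡ true → (if b then x else y) ≡ x
if-true x y refl = refl

if-false : ∀ {A : Set} {b : Bool} (x y : A) → b ≡ false → (if b then x else y) ≡ y
if-false x y refl = refl

==-true : ∀ {n} {a b : Fin n} → a ≡ b → (a == b) ≡ true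
==-true {a = a} {b} a≡b with a ≟ b
... | yes _ = refl
... | no a≢b = ⊥-elim (a≢b a≡b)

==-false : ∀ {n} {a b : Fin n} → a ≢ b → (a == b) ≡ false
==-false {a = a} {b} a≢b with a ≟ b
... | yes a≡b = ⊥-elim (a≢b a≡b)
... | no _ = refl

==-refl : ∀ {n} (a : Fin n) → (a == a) ≡ true
==-refl a = ==-true refl

==⇒≡ : ∀ {n} {a b : Fin n} → (a == b) ≡ true → a ≡ b
==⇒≡ {a = a} {b} e with a ≟ b
... | yes a≡b = a≡b

==-sym : ∀ {n} (a b : Fin n) → (a == b) ≡ (b == a)
==-sym a b = ≡true-⇔ (λ e → ==-true (sym (==⇒≡ e))) (λ e → ==-true (sym (==⇒≡ e)))

∑ : {A : Set} → List A → (A → ℕ) → ℕ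
∑ [] f = 0
∑ (x ∷ xs) f = f x + ∑ xs f

countIn : {A : Set} → (A → Bool) → List A → ℕ
countIn p xs = length (filterᵇ p xs)

countIn≡∑ : {A : Set} (p : A → Bool) (xs : List A) → countIn p xs ≡ ∑ xs (λ a → bit (p a))
countIn≡∑ p [] = refl
countIn≡∑ p (x ∷ xs) with p x
... | true = cong suc (countIn≡∑ p xs)
... | false = countIn≡∑ p xs

∑-cong : {A : Set} (xs : List A) {f g : A → ℕ} → (∀ a → f a ≡ g a) → ∑ xs f ≡ ∑ xs g
∑-cong [] e = refl
∑-cong (x ∷ xs) e = cong₂ _+_ (e x) (∑-cong xs e)

∑-++ : {A : Set} (xs ys : List A) (f : A → ℕ) → ∑ (xs ++ ys) f ≡ ∑ xs f + ∑ ys f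
∑-++ [] ys f = refl
∑-++ (x ∷ xs) ys f = trans (cong (f x +_) (∑-++ xs ys f)) (sym (+-assoc (f x) _ _))

∑-map : {A B : Set} (h : A → B) (xs : List A) (f : B → ℕ) → ∑ (map h xs) f ≡ ∑ xs (λ a → f (h a))
∑-map h [] f = refl
∑-map h (x ∷ xs) f = cong (f (h x) +_) (∑-map h xs f)

∑-concatMap : {A B : Set} (h : A → List B) (xs : List A) (f : B → ℕ) →
  ∑ (concatMap h xs) f ≡ ∑ xs (λ a → ∑ (h a) f)
∑-concatMap h [] f = refl
∑-concatMap h (x ∷ xs) f = trans (∑-++ (h x) (concatMap h xs) f) (cong (∑ (h x) f +_) (∑-concatMap h xs f))

∑-+ : {A : Set} (xs : List A) (f g : A → ℕ) → ∑ xs (λ a → f a + g a) ≡ ∑ xs f + ∑ xs g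
∑-+ [] f g = refl
∑-+ (x ∷ xs) f g rewrite ∑-+ xs f g = interchange (f x) (g x) (∑ xs f) (∑ xs g)
  where
  interchange : ∀ a b c d → a + b + (c + d) ≡ a + c + (b + d)
  interchange a b c d rewrite +-assoc a b (c + d) | sym (+-assoc b c d) | +-comm b c | +-assoc c b d
                            | sym (+-assoc a c (b + d)) = refl

∑-*ˡ : {A : Set} (xs : List A) (k : ℕ) (f : A → ℕ) → ∑ xs (λ a → k * f a) ≡ k * ∑ xs f
∑-*ˡ [] k f = sym (*-zeroʳ k)
∑-*ˡ (x ∷ xs) k f = trans (cong (k * f x +_) (∑-*ˡ xs k f)) (sym (*-distribˡ-+ k (f x) (∑ xs f)))

∑-zero : {A : Set} (xs : List A) (f : A → ℕ) → (∀ a → f a ≡ 0) → ∑ xs f ≡ 0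
∑-zero [] f e = refl
∑-zero (x ∷ xs) f e rewrite e x = ∑-zero xs f e

∑-comm : {A B : Set} (xs : List A) (ys : List B) (h : A → B → ℕ) →
  ∑ xs (λ a → ∑ ys (h a)) ≡ ∑ ys (λ b → ∑ xs (λ a → h a b))
∑-comm [] ys h = sym (∑-zero ys (λ b → 0) (λ _ → refl))
∑-comm (x ∷ xs) ys h = trans (cong (∑ ys (h x) +_) (∑-comm xs ys h))
  (sym (∑-+ ys (h x) (λ b → ∑ xs (λ a → h a b))))

countIn-cong : {A : Set} {p q : A → Bool} (xs : List A) → (∀ a → p a ≡ q a) → countIn p xs ≡ countIn q xs
countIn-cong {p = p} {q} xs e =
  trans (countIn≡∑ p xs) (trans (∑-cong xs (λ a → cong bit (e a))) (sym (countIn≡∑ q xs)))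

∑Fin : ∀ {n} → (Fin n → ℕ) → ℕ
∑Fin {zero} f = 0
∑Fin {suc n} f = f zero + ∑Fin (λ x → f (suc x))

∑-tabulate : ∀ {n} {A : Set} (h : Fin n → A) (f : A → ℕ) → ∑ (tabulate h) f ≡ ∑Fin (λ x → f (h x))
∑-tabulate {zero} h f = refl
∑-tabulate {suc n} h f = cong (f (h zero) +_) (∑-tabulate (λ x → h (suc x)) f)

∑-allFin : ∀ {n} (f : Fin n → ℕ) → ∑ (allFin n) f ≡ ∑Fin f
∑-allFin f = ∑-tabulate (λ x → x) f

∑Fin-cong : ∀ {n} {f g : Fin n → ℕ} → (∀ a → f a ≡ g a) → ∑Fin f ≡ ∑Fin g
∑Fin-cong {zero} e = refl
∑Fin-cong {suc n} e = cong₂ _+_ (e zero) (∑Fin-cong (λ x → e (suc x)))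

∑Fin-zero : ∀ {n} (f : Fin n → ℕ) → (∀ a → f a ≡ 0) → ∑Fin f ≡ 0
∑Fin-zero {zero} f e = refl
∑Fin-zero {suc n} f e rewrite e zero = ∑Fin-zero (λ x → f (suc x)) (λ x → e (suc x))

∑Fin-+ : ∀ {n} (f g : Fin n → ℕ) → ∑Fin (λ x → f x + g x) ≡ ∑Fin f + ∑Fin g
∑Fin-+ f g = trans (sym (∑-allFin (λ x → f x + g x)))
  (trans (∑-+ (allFin _) f g) (cong₂ _+_ (∑-allFin f) (∑-allFin g)))

∑Fin-delta : ∀ {n} (a : Fin n) (f : Fin n → ℕ) → ∑Fin (λ x → bit (a == x) * f x) ≡ f a
∑Fin-delta {suc n} zero f =
  trans (cong₂ _+_ (*-identityˡ (f zero)) (∑Fin-zero (λ x → bit (zero == suc x) * f (suc x)) (λ _ → refl)))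
        (+-identityʳ _)
∑Fin-delta {suc n} (suc a) f =
  trans (∑Fin-cong (λ x → cong (λ b → bit b * f (suc x)) (suc==suc a x))) (∑Fin-delta a (λ x → f (suc x)))
  where
  suc==suc : ∀ {n} (a b : Fin n) → (suc a == suc b) ≡ (a == b)
  suc==suc a b with a ≟ b
  ... | yes _ = refl
  ... | no _ = refl

count≡∑Fin : ∀ {n} (p : Fin n → Bool) → count p ≡ ∑Fin (λ x → bit (p x))
count≡∑Fin p = trans (countIn≡∑ p (allFin _)) (∑-allFin (λ x → bit (p x)))

search : ∀ {k} (p : Fin k → Bool) → Σ (Fin k) (λ x → p x ≡ true) ⊎ (∀ x → p x ≡ false)
search {zero} p = inj₂ (λ ())
search {suc k} p with p zero in p0
... | true = inj₁ (zero , p0)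
... | false with search (λ x → p (suc x))
...   | inj₁ (x , e) = inj₁ (suc x , e)
...   | inj₂ h = inj₂ (λ { zero → p0 ; (suc x) → h x })

least : ∀ {k} (p : Fin k → Bool) x → p x ≡ true →
  Σ (Fin k) (λ y → p y ≡ true × (∀ z → toℕ z < toℕ y → p z ≡ false))
least p zero px = zero , px , (λ z ())
least p (suc x) px with p zero in p0
... | true = zero , p0 , (λ z ())
... | false with least (λ i → p (suc i)) x px
...   | y , py , minimal = suc y , py , below-suc
  where
  below-suc : ∀ z → toℕ z < toℕ (suc y) → p z ≡ false
  below-suc zero _ = p0
  below-suc (suc z) (s≤s lt) = minimal z lt

∑Fin-bit≥1 : ∀ {n} (p : Fin n → Bool) y → p y ≡ true → 1 ≤ ∑Fin (λ x → bit (p x))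
∑Fin-bit≥1 p zero e rewrite e = s≤s z≤n
∑Fin-bit≥1 p (suc y) e = ≤-trans (∑Fin-bit≥1 (λ x → p (suc x)) y e) (m≤n+m _ (bit (p zero)))

∑Fin-bit≥2 : ∀ {n} (p : Fin n → Bool) y z → p y ≡ true → p z ≡ true → y ≢ z → 2 ≤ ∑Fin (λ x → bit (p x))
∑Fin-bit≥2 p zero zero ey ez y≢z = ⊥-elim (y≢z refl)
∑Fin-bit≥2 p zero (suc z) ey ez y≢z rewrite ey = s≤s (∑Fin-bit≥1 (λ x → p (suc x)) z ez)
∑Fin-bit≥2 p (suc y) zero ey ez y≢z rewrite ez = s≤s (∑Fin-bit≥1 (λ x → p (suc x)) y ey)
∑Fin-bit≥2 p (suc y) (suc z) ey ez y≢z =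
  ≤-trans (∑Fin-bit≥2 (λ x → p (suc x)) y z ey ez (λ e → y≢z (cong suc e))) (m≤n+m _ (bit (p zero)))

∑Fin-bit≤1 : ∀ {n} (p : Fin n → Bool) (v : Fin n) → (∀ w → w ≢ v → p w ≡ false) → ∑Fin (λ x → bit (p x)) ≤ 1
∑Fin-bit≤1 {suc n} p zero h rewrite ∑Fin-zero (λ x → bit (p (suc x))) (λ x → cong bit (h (suc x) (λ ()))) with p zero
... | true = s≤s z≤n
... | false = z≤n
∑Fin-bit≤1 {suc n} p (suc v) h rewrite h zero (λ ()) =
  ∑Fin-bit≤1 (λ x → p (suc x)) v (λ w w≢v → h (suc w) (λ e → w≢v (Fin.suc-injective e)))

∑Fin-bit-insert : ∀ {n} (p q : Fin n → Bool) (v : Fin n) → (∀ x → x ≢ v → q x ≡ p x) → p v ≡ false → q v ≡ true →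
  ∑Fin (λ x → bit (q x)) ≡ suc (∑Fin (λ x → bit (p x)))
∑Fin-bit-insert p q zero h pv qv rewrite pv | qv = cong suc (∑Fin-cong (λ x → cong bit (h (suc x) (λ ()))))
∑Fin-bit-insert p q (suc v) h pv qv rewrite h zero (λ ()) =
  trans (cong (bit (p zero) +_)
          (∑Fin-bit-insert (λ x → p (suc x)) (λ x → q (suc x)) v
            (λ x x≢v → h (suc x) (λ e → x≢v (Fin.suc-injective e))) pv qv))
        (+-suc (bit (p zero)) _)

_==ᴸ_ : List ℕ → List ℕ → Bool
[] ==ᴸ [] = true
[] ==ᴸ (b ∷ bs) = false
(a ∷ as) ==ᴸ [] = false
(a ∷ as) ==ᴸ (b ∷ bs) = (a ≡ᵇ b) ∧ (as ==ᴸ bs)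

_≤ᴸ_ : List ℕ → List ℕ → Bool
[] ≤ᴸ [] = true
[] ≤ᴸ (b ∷ bs) = false
(a ∷ as) ≤ᴸ [] = false
(a ∷ as) ≤ᴸ (b ∷ bs) = (a <ᵇ suc b) ∧ (as ≤ᴸ bs)

≡ᵇ-true⇒≡ : ∀ {m n} → (m ≡ᵇ n) ≡ true → m ≡ n
≡ᵇ-true⇒≡ {m} {n} e = ≡ᵇ⇒≡ m n (subst T (sym e) tt)

+-≡ᵇ-split : ∀ g d a → (g + d ≡ᵇ a) ≡ ((g <ᵇ suc a) ∧ (d ≡ᵇ a ∸ g))
+-≡ᵇ-split zero d a = refl
+-≡ᵇ-split (suc g) d zero = refl
+-≡ᵇ-split (suc g) d (suc a) = +-≡ᵇ-split g d a

∧-interchange : ∀ a b c d → ((a ∧ b) ∧ (c ∧ d)) ≡ ((a ∧ c) ∧ (b ∧ d))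
∧-interchange true b true d = refl
∧-interchange true b false d = ∧-zeroʳ b
∧-interchange false b c d = refl

zipWith+-==ᴸ : ∀ γ δ α → length γ ≡ length α → length δ ≡ length α →
  (zipWith _+_ γ δ ==ᴸ α) ≡ ((γ ≤ᴸ α) ∧ (δ ==ᴸ zipWith _∸_ α γ))
zipWith+-==ᴸ [] [] [] _ _ = refl
zipWith+-==ᴸ (g ∷ γ) (d ∷ δ) (a ∷ α) e₁ e₂ =
  trans (cong₂ _∧_ (+-≡ᵇ-split g d a) (zipWith+-==ᴸ γ δ α (suc-injective e₁) (suc-injective e₂)))
        (∧-interchange (g <ᵇ suc a) (d ≡ᵇ a ∸ g) (γ ≤ᴸ α) (δ ==ᴸ zipWith _∸_ α γ))

∑-upTo-≡ᵇ : ∀ g k → ∑ (upTo k) (λ b → bit (g ≡ᵇ b)) ≡ bit (g <ᵇ k)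
∑-upTo-≡ᵇ g zero = refl
∑-upTo-≡ᵇ g (suc k) = begin
  ∑ (upTo (suc k)) f             ≡⟨ cong (λ l → ∑ l f) (sym (upTo-∷ʳ k)) ⟩
  ∑ (upTo k ∷ʳ k) f              ≡⟨ ∑-++ (upTo k) (k ∷ []) f ⟩
  ∑ (upTo k) f + (f k + 0)       ≡⟨ cong₂ _+_ (∑-upTo-≡ᵇ g k) (+-identityʳ (f k)) ⟩
  bit (g <ᵇ k) + bit (g ≡ᵇ k)    ≡⟨ <ᵇ-or-≡ᵇ g k ⟩
  bit (g <ᵇ suc k)               ∎
  where
  open ≡-Reasoning
  f : ℕ → ℕ
  f b = bit (g ≡ᵇ b)
  <ᵇ-or-≡ᵇ : ∀ g k → bit (g <ᵇ k) + bit (g ≡ᵇ k) ≡ bit (g <ᵇ suc k)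
  <ᵇ-or-≡ᵇ zero zero = refl
  <ᵇ-or-≡ᵇ zero (suc k) = refl
  <ᵇ-or-≡ᵇ (suc g) zero = refl
  <ᵇ-or-≡ᵇ (suc g) (suc k) = <ᵇ-or-≡ᵇ g k

∑-upTo-select : ∀ g k (F : ℕ → ℕ) → ∑ (upTo k) (λ b → bit (g ≡ᵇ b) * F b) ≡ bit (g <ᵇ k) * F g
∑-upTo-select g k F =
  trans (∑-cong (upTo k) select)
    (trans (∑-*ˡ (upTo k) (F g) (λ b → bit (g ≡ᵇ b)))
      (trans (cong (F g *_) (∑-upTo-≡ᵇ g k)) (*-comm (F g) _)))
  where
  select : ∀ b → bit (g ≡ᵇ b) * F b ≡ F g * bit (g ≡ᵇ b)
  select b with g ≡ᵇ b in e
  ... | true rewrite ≡ᵇ-true⇒≡ {g} {b} e = *-comm 1 (F b)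
  ... | false = *-comm 0 (F g)

below-length : ∀ α → All (λ β → length β ≡ length α) (below α)
below-length [] = refl ∷ []
below-length (a ∷ α) =
  concat⁺ (map⁺ (universal (λ b → map⁺ (All.map (cong suc) (below-length α))) (upTo (suc a))))

∑-below-select : ∀ α γ (F : List ℕ → ℕ) → length γ ≡ length α →
  ∑ (below α) (λ β → bit (γ ==ᴸ β) * F β) ≡ bit (γ ≤ᴸ α) * F γ
∑-below-select [] [] F e = +-identityʳ _
∑-below-select (a ∷ α) (g ∷ γ) F e = begin
  ∑ (below (a ∷ α)) (λ β → bit ((g ∷ γ) ==ᴸ β) * F β)
    ≡⟨ ∑-concatMap (λ b → map (b ∷_) (below α)) (upTo (suc a)) _ ⟩
  ∑ (upTo (suc a)) (λ b → ∑ (map (b ∷_) (below α)) (λ β → bit ((g ∷ γ) ==ᴸ β) * F β))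
    ≡⟨ ∑-cong (upTo (suc a)) inner ⟩
  ∑ (upTo (suc a)) (λ b → bit (g ≡ᵇ b) * (bit (γ ≤ᴸ α) * F (b ∷ γ)))
    ≡⟨ ∑-upTo-select g (suc a) (λ b → bit (γ ≤ᴸ α) * F (b ∷ γ)) ⟩
  bit (g <ᵇ suc a) * (bit (γ ≤ᴸ α) * F (g ∷ γ))
    ≡⟨ sym (*-assoc (bit (g <ᵇ suc a)) _ _) ⟩
  bit (g <ᵇ suc a) * bit (γ ≤ᴸ α) * F (g ∷ γ)
    ≡⟨ cong (_* F (g ∷ γ)) (sym (bit-∧ (g <ᵇ suc a) (γ ≤ᴸ α))) ⟩
  bit ((g ∷ γ) ≤ᴸ (a ∷ α)) * F (g ∷ γ) ∎
  where
  open ≡-Reasoning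
  inner : ∀ b → ∑ (map (b ∷_) (below α)) (λ β → bit ((g ∷ γ) ==ᴸ β) * F β)
              ≡ bit (g ≡ᵇ b) * (bit (γ ≤ᴸ α) * F (b ∷ γ))
  inner b = begin
    ∑ (map (b ∷_) (below α)) (λ β → bit ((g ∷ γ) ==ᴸ β) * F β)
      ≡⟨ ∑-map (b ∷_) (below α) _ ⟩
    ∑ (below α) (λ β → bit ((g ≡ᵇ b) ∧ (γ ==ᴸ β)) * F (b ∷ β))
      ≡⟨ ∑-cong (below α) (λ β → trans (cong (_* F (b ∷ β)) (bit-∧ (g ≡ᵇ b) (γ ==ᴸ β)))
                                       (*-assoc (bit (g ≡ᵇ b)) _ _)) ⟩
    ∑ (below α) (λ β → bit (g ≡ᵇ b) * (bit (γ ==ᴸ β) * F (b ∷ β)))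
      ≡⟨ ∑-*ˡ (below α) (bit (g ≡ᵇ b)) _ ⟩
    bit (g ≡ᵇ b) * ∑ (below α) (λ β → bit (γ ==ᴸ β) * F (b ∷ β))
      ≡⟨ cong (bit (g ≡ᵇ b) *_) (∑-below-select α γ (λ β → F (b ∷ β)) (suc-injective e)) ⟩
    bit (g ≡ᵇ b) * (bit (γ ≤ᴸ α) * F (b ∷ γ)) ∎

zipWith∸-length : ∀ α β → length β ≡ length α → length (zipWith _∸_ α β) ≡ length α
zipWith∸-length [] [] e = refl
zipWith∸-length (a ∷ α) (b ∷ β) e = cong suc (zipWith∸-length α β (suc-injective e))

pairs : {A B : Set} → List A → List B → List (A × B)
pairs xs ys = concatMap (λ a → map (a ,_) ys) xs

∑-pairs : {A B : Set} (xs : List A) (ys : List B) (f : A × B → ℕ) →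
  ∑ (pairs xs ys) f ≡ ∑ xs (λ a → ∑ ys (λ b → f (a , b)))
∑-pairs xs ys f = trans (∑-concatMap _ xs f) (∑-cong xs (λ a → ∑-map _ ys f))

∧-rearrange : ∀ p q l r → (p ∧ (l ∧ (q ∧ r))) ≡ ((p ∧ q) ∧ (l ∧ r))
∧-rearrange false q l r = refl
∧-rearrange true true l r = refl
∧-rearrange true false l r = ∧-zeroʳ l

convolution-fibre : {B : Set} (ys : List B) (c₂ : B → List ℕ) (g₂ : B → Bool) (α γ : List ℕ) (g : Bool) →
  length γ ≡ length α → (∀ b → length (c₂ b) ≡ length α) →
  ∑ (below α) (λ β → countIn (λ b → g₂ b ∧ (c₂ b ==ᴸ zipWith _∸_ α β)) ys * bit (g ∧ (γ ==ᴸ β)))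
  ≡ ∑ ys (λ b → bit ((g ∧ g₂ b) ∧ (zipWith _+_ γ (c₂ b) ==ᴸ α)))
convolution-fibre ys c₂ g₂ α γ g lenγ len₂ = begin
  ∑ (below α) (λ β → N β * bit (g ∧ (γ ==ᴸ β)))
    ≡⟨ ∑-cong (below α) (λ β → trans (cong (N β *_) (bit-∧ g (γ ==ᴸ β))) (rotate (N β) (bit g) (bit (γ ==ᴸ β)))) ⟩
  ∑ (below α) (λ β → bit g * (bit (γ ==ᴸ β) * N β))
    ≡⟨ ∑-*ˡ (below α) (bit g) _ ⟩
  bit g * ∑ (below α) (λ β → bit (γ ==ᴸ β) * N β)
    ≡⟨ cong (bit g *_) (∑-below-select α γ N lenγ) ⟩
  bit g * (bit (γ ≤ᴸ α) * N γ)
    ≡⟨ cong (λ z → bit g * (bit (γ ≤ᴸ α) * z)) (countIn≡∑ _ ys) ⟩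
  bit g * (bit (γ ≤ᴸ α) * ∑ ys (λ b → bit (g₂ b ∧ (c₂ b ==ᴸ zipWith _∸_ α γ))))
    ≡⟨ cong (bit g *_) (sym (∑-*ˡ ys (bit (γ ≤ᴸ α)) _)) ⟩
  bit g * ∑ ys (λ b → bit (γ ≤ᴸ α) * bit (g₂ b ∧ (c₂ b ==ᴸ zipWith _∸_ α γ)))
    ≡⟨ sym (∑-*ˡ ys (bit g) _) ⟩
  ∑ ys (λ b → bit g * (bit (γ ≤ᴸ α) * bit (g₂ b ∧ (c₂ b ==ᴸ zipWith _∸_ α γ))))
    ≡⟨ ∑-cong ys pair-condition ⟩
  ∑ ys (λ b → bit ((g ∧ g₂ b) ∧ (zipWith _+_ γ (c₂ b) ==ᴸ α))) ∎
  where
  open ≡-Reasoning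
  N : List ℕ → ℕ
  N β = countIn (λ b → g₂ b ∧ (c₂ b ==ᴸ zipWith _∸_ α β)) ys
  rotate : ∀ x a b → x * (a * b) ≡ a * (b * x)
  rotate x a b = trans (*-comm x (a * b)) (*-assoc a b x)
  pair-condition : ∀ b → bit g * (bit (γ ≤ᴸ α) * bit (g₂ b ∧ (c₂ b ==ᴸ zipWith _∸_ α γ)))
                        ≡ bit ((g ∧ g₂ b) ∧ (zipWith _+_ γ (c₂ b) ==ᴸ α))
  pair-condition b = begin
    bit g * (bit (γ ≤ᴸ α) * bit (g₂ b ∧ (c₂ b ==ᴸ zipWith _∸_ α γ)))
      ≡⟨ cong (bit g *_) (sym (bit-∧ (γ ≤ᴸ α) _)) ⟩
    bit g * bit ((γ ≤ᴸ α) ∧ (g₂ b ∧ (c₂ b ==ᴸ zipWith _∸_ α γ)))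
      ≡⟨ sym (bit-∧ g _) ⟩
    bit (g ∧ ((γ ≤ᴸ α) ∧ (g₂ b ∧ (c₂ b ==ᴸ zipWith _∸_ α γ))))
      ≡⟨ cong bit (∧-rearrange g (g₂ b) (γ ≤ᴸ α) (c₂ b ==ᴸ zipWith _∸_ α γ)) ⟩
    bit ((g ∧ g₂ b) ∧ ((γ ≤ᴸ α) ∧ (c₂ b ==ᴸ zipWith _∸_ α γ)))
      ≡⟨ cong (λ z → bit ((g ∧ g₂ b) ∧ z)) (sym (zipWith+-==ᴸ γ (c₂ b) α lenγ (len₂ b))) ⟩
    bit ((g ∧ g₂ b) ∧ (zipWith _+_ γ (c₂ b) ==ᴸ α)) ∎

count-convolution : {A B : Set} (xs : List A) (ys : List B) (c₁ : A → List ℕ) (c₂ : B → List ℕ)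
  (g₁ : A → Bool) (g₂ : B → Bool) (α : List ℕ) →
  (∀ a → length (c₁ a) ≡ length α) → (∀ b → length (c₂ b) ≡ length α) →
  ∑ (below α) (λ β → countIn (λ a → g₁ a ∧ (c₁ a ==ᴸ β)) xs
                     * countIn (λ b → g₂ b ∧ (c₂ b ==ᴸ zipWith _∸_ α β)) ys)
  ≡ countIn (λ ab → (g₁ (proj₁ ab) ∧ g₂ (proj₂ ab)) ∧ (zipWith _+_ (c₁ (proj₁ ab)) (c₂ (proj₂ ab)) ==ᴸ α))
            (pairs xs ys)
count-convolution {A} {B} xs ys c₁ c₂ g₁ g₂ α len₁ len₂ = begin
  ∑ (below α) (λ β → countIn (λ a → g₁ a ∧ (c₁ a ==ᴸ β)) xs * N₂ β)
    ≡⟨ ∑-cong (below α) (λ β → trans (cong (_* N₂ β) (countIn≡∑ _ xs))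
                                     (trans (*-comm (∑ xs _) (N₂ β)) (sym (∑-*ˡ xs (N₂ β) _)))) ⟩
  ∑ (below α) (λ β → ∑ xs (λ a → N₂ β * bit (g₁ a ∧ (c₁ a ==ᴸ β))))
    ≡⟨ sym (∑-comm xs (below α) _) ⟩
  ∑ xs (λ a → ∑ (below α) (λ β → N₂ β * bit (g₁ a ∧ (c₁ a ==ᴸ β))))
    ≡⟨ ∑-cong xs (λ a → convolution-fibre ys c₂ g₂ α (c₁ a) (g₁ a) (len₁ a) len₂) ⟩
  ∑ xs (λ a → ∑ ys (λ b → bit (good (a , b))))
    ≡⟨ sym (trans (countIn≡∑ good (pairs xs ys)) (∑-pairs xs ys (λ ab → bit (good ab)))) ⟩
  countIn good (pairs xs ys) ∎
  where
  open ≡-Reasoning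
  N₂ : List ℕ → ℕ
  N₂ β = countIn (λ b → g₂ b ∧ (c₂ b ==ᴸ zipWith _∸_ α β)) ys
  good : A × B → Bool
  good ab = (g₁ (proj₁ ab) ∧ g₂ (proj₂ ab)) ∧ (zipWith _+_ (c₁ (proj₁ ab)) (c₂ (proj₂ ab)) ==ᴸ α)

-- Colourings are functions, compared pointwise; counts are therefore transported along
-- correspondences that are bijective only up to a Boolean-valued equivalence.
record BoolSetoid (A : Set) : Set where
  field
    _≈ᵇ_ : A → A → Bool
    ≈-refl : ∀ a → (a ≈ᵇ a) ≡ true
    ≈-sym : ∀ a b → (a ≈ᵇ b) ≡ true → (b ≈ᵇ a) ≡ true
    ≈-trans : ∀ a b c → (a ≈ᵇ b) ≡ true → (b ≈ᵇ c) ≡ true → (a ≈ᵇ c) ≡ true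

open BoolSetoid using (_≈ᵇ_)

Enumerates : {A : Set} → BoolSetoid A → List A → Set
Enumerates E xs = ∀ a → ∑ xs (λ x → bit (_≈ᵇ_ E a x)) ≡ 1

enumerates-spread : {B : Set} {EB : BoolSetoid B} (ys : List B) → Enumerates EB ys →
  ∀ p t → bit p ≡ ∑ ys (λ b → bit (p ∧ _≈ᵇ_ EB t b))
enumerates-spread {EB = EB} ys enum p t = begin
  bit p                                   ≡⟨ sym (*-identityʳ (bit p)) ⟩
  bit p * 1                               ≡⟨ cong (bit p *_) (sym (enum t)) ⟩
  bit p * ∑ ys (λ b → bit (t ≈ b))        ≡⟨ sym (∑-*ˡ ys (bit p) _) ⟩
  ∑ ys (λ b → bit p * bit (t ≈ b))        ≡⟨ ∑-cong ys (λ b → sym (bit-∧ p _)) ⟩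
  ∑ ys (λ b → bit (p ∧ (t ≈ b)))          ∎
  where
  open ≡-Reasoning
  open BoolSetoid EB renaming (_≈ᵇ_ to _≈_)

record Correspondence {A B : Set} (EA : BoolSetoid A) (EB : BoolSetoid B) (p : A → Bool) (q : B → Bool) : Set where
  open BoolSetoid EA renaming (_≈ᵇ_ to _≈ᴬ_)
  open BoolSetoid EB renaming (_≈ᵇ_ to _≈ᴮ_)
  field
    to : A → B
    from : (b : B) → q b ≡ true → A
    p-resp : ∀ a a′ → (a ≈ᴬ a′) ≡ true → p a ≡ true → p a′ ≡ true
    q-resp : ∀ b b′ → (b ≈ᴮ b′) ≡ true → q b ≡ true → q b′ ≡ true
    to-good : ∀ a → p a ≡ true → q (to a) ≡ true
    from-good : ∀ b qb → p (from b qb) ≡ true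
    from-to : ∀ a → p a ≡ true → ∀ qa → (from (to a) qa ≈ᴬ a) ≡ true
    to-from : ∀ b qb → (to (from b qb) ≈ᴮ b) ≡ true
    to-cong : ∀ a a′ → p a ≡ true → (a ≈ᴬ a′) ≡ true → (to a ≈ᴮ to a′) ≡ true
    from-cong : ∀ b b′ qb qb′ → (b ≈ᴮ b′) ≡ true → (from b qb ≈ᴬ from b′ qb′) ≡ true

count-correspondence : {A B : Set} {EA : BoolSetoid A} {EB : BoolSetoid B} {p : A → Bool} {q : B → Bool}
  (xs : List A) (ys : List B) → Enumerates EA xs → Enumerates EB ys →
  Correspondence EA EB p q → countIn p xs ≡ countIn q ys
count-correspondence {EA = EA} {EB} {p} {q} xs ys enumA enumB C = begin
  countIn p xs                                                  ≡⟨ countIn≡∑ p xs ⟩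
  ∑ xs (λ a → bit (p a))                                        ≡⟨ ∑-cong xs (λ a → enumerates-spread {EB = EB} ys enumB (p a) (to a)) ⟩
  ∑ xs (λ a → ∑ ys (λ b → bit (p a ∧ (to a ≈ᴮ b))))             ≡⟨ ∑-comm xs ys _ ⟩
  ∑ ys (λ b → ∑ xs (λ a → bit (p a ∧ (to a ≈ᴮ b))))             ≡⟨ ∑-cong ys fibre ⟩
  ∑ ys (λ b → bit (q b))                                        ≡⟨ sym (countIn≡∑ q ys) ⟩
  countIn q ys                                                  ∎
  where
  open ≡-Reasoning
  open Correspondence C
  open BoolSetoid EA renaming (_≈ᵇ_ to _≈ᴬ_; ≈-sym to symᴬ; ≈-trans to transᴬ)
  open BoolSetoid EB renaming (_≈ᵇ_ to _≈ᴮ_; ≈-sym to symᴮ; ≈-trans to transᴮ)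
  fibre : ∀ b → ∑ xs (λ a → bit (p a ∧ (to a ≈ᴮ b))) ≡ bit (q b)
  fibre b with q b in qb
  ... | true = trans (∑-cong xs (λ a → cong bit (≡true-⇔ (onto a) (back a)))) (enumA (from b qb))
    where
    onto : ∀ a → (p a ∧ (to a ≈ᴮ b)) ≡ true → (from b qb ≈ᴬ a) ≡ true
    onto a e = symᴬ a (from b qb) (transᴬ a (from (to a) qa) (from b qb)
                 (symᴬ (from (to a) qa) a (from-to a pa qa)) (from-cong (to a) b qa qb (∧-elimʳ {p a} e)))
      where
      pa : p a ≡ true
      pa = ∧-elimˡ e
      qa : q (to a) ≡ true
      qa = to-good a pa
    back : ∀ a → (from b qb ≈ᴬ a) ≡ true → (p a ∧ (to a ≈ᴮ b)) ≡ true
    back a e = ∧-intro (p-resp (from b qb) a e (from-good b qb))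
                 (transᴮ (to a) (to (from b qb)) b (symᴮ (to (from b qb)) (to a) (to-cong (from b qb) a (from-good b qb) e))
                         (to-from b qb))
  ... | false = ∑-zero xs _ (λ a → cong bit (no-preimage a))
    where
    no-preimage : ∀ a → (p a ∧ (to a ≈ᴮ b)) ≡ false
    no-preimage a with p a in pa | to a ≈ᴮ b in e
    ... | false | _ = refl
    ... | true | false = refl
    ... | true | true = ⊥-elim (true≢false (q-resp (to a) b e (to-good a pa)) qb)

∀ᵇ : ∀ {n} → (Fin n → Bool) → Bool
∀ᵇ {zero} p = true
∀ᵇ {suc n} p = p zero ∧ ∀ᵇ (λ x → p (suc x))

all-tabulate : ∀ {A : Set} {n} (h : Fin n → A) (p : A → Bool) → all p (tabulate h) ≡ ∀ᵇ (λ x → p (h x))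
all-tabulate {n = zero} h p = refl
all-tabulate {n = suc n} h p = cong (p (h zero) ∧_) (all-tabulate (λ x → h (suc x)) p)

all-allFin : ∀ {n} (p : Fin n → Bool) → all p (allFin n) ≡ ∀ᵇ p
all-allFin p = all-tabulate (λ x → x) p

∀ᵇ-elim : ∀ {n} (p : Fin n → Bool) → ∀ᵇ p ≡ true → ∀ x → p x ≡ true
∀ᵇ-elim {suc n} p e zero = ∧-elimˡ e
∀ᵇ-elim {suc n} p e (suc x) = ∀ᵇ-elim (λ y → p (suc y)) (∧-elimʳ {p zero} e) x

∀ᵇ-intro : ∀ {n} (p : Fin n → Bool) → (∀ x → p x ≡ true) → ∀ᵇ p ≡ true
∀ᵇ-intro {zero} p e = refl
∀ᵇ-intro {suc n} p e = ∧-intro (e zero) (∀ᵇ-intro (λ y → p (suc y)) (λ y → e (suc y)))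

∀ᵇ-cong : ∀ {n} {p q : Fin n → Bool} → (∀ x → p x ≡ q x) → ∀ᵇ p ≡ ∀ᵇ q
∀ᵇ-cong {zero} e = refl
∀ᵇ-cong {suc n} e = cong₂ _∧_ (e zero) (∀ᵇ-cong (λ x → e (suc x)))

Colouring : ℕ → ℕ → Set
Colouring n m = Fin n → Fin m

_≗ᵇ_ : ∀ {n m} → Colouring n m → Colouring n m → Bool
κ ≗ᵇ κ′ = ∀ᵇ (λ x → κ x == κ′ x)

≗ᵇ⇒≗ : ∀ {n m} {κ κ′ : Colouring n m} → (κ ≗ᵇ κ′) ≡ true → ∀ x → κ x ≡ κ′ x
≗ᵇ⇒≗ {κ = κ} {κ′} e x = ==⇒≡ (∀ᵇ-elim (λ x → κ x == κ′ x) e x)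

≗⇒≗ᵇ : ∀ {n m} {κ κ′ : Colouring n m} → (∀ x → κ x ≡ κ′ x) → (κ ≗ᵇ κ′) ≡ true
≗⇒≗ᵇ {κ = κ} {κ′} e = ∀ᵇ-intro (λ x → κ x == κ′ x) (λ x → ==-true (e x))

finSetoid : ∀ n → BoolSetoid (Fin n)
finSetoid n = record
  { _≈ᵇ_ = _==_
  ; ≈-refl = ==-refl
  ; ≈-sym = λ a b e → ==-true (sym (==⇒≡ e))
  ; ≈-trans = λ a b c e e′ → ==-true (trans (==⇒≡ e) (==⇒≡ e′))
  }

colouringSetoid : ∀ n m → BoolSetoid (Colouring n m)
colouringSetoid n m = record
  { _≈ᵇ_ = _≗ᵇ_
  ; ≈-refl = λ κ → ≗⇒≗ᵇ {κ = κ} (λ x → refl)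
  ; ≈-sym = λ κ κ′ e → ≗⇒≗ᵇ {κ = κ′} (λ x → sym (≗ᵇ⇒≗ {κ = κ} e x))
  ; ≈-trans = λ κ κ′ κ″ e e′ → ≗⇒≗ᵇ {κ = κ} (λ x → trans (≗ᵇ⇒≗ {κ = κ} e x) (≗ᵇ⇒≗ {κ = κ′} e′ x))
  }

×-setoid : {A B : Set} → BoolSetoid A → BoolSetoid B → BoolSetoid (A × B)
×-setoid EA EB = record
  { _≈ᵇ_ = λ { (a , b) (a′ , b′) → (a ≈ᴬ a′) ∧ (b ≈ᴮ b′) }
  ; ≈-refl = λ { (a , b) → ∧-intro (reflᴬ a) (reflᴮ b) }
  ; ≈-sym = λ { (a , b) (a′ , b′) e → ∧-intro (symᴬ a a′ (∧-elimˡ e)) (symᴮ b b′ (∧-elimʳ {a ≈ᴬ a′} e)) }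
  ; ≈-trans = λ { (a , b) (a′ , b′) (a″ , b″) e e′ →
      ∧-intro (transᴬ a a′ a″ (∧-elimˡ e) (∧-elimˡ e′))
              (transᴮ b b′ b″ (∧-elimʳ {a ≈ᴬ a′} e) (∧-elimʳ {a′ ≈ᴬ a″} e′)) }
  }
  where
  open BoolSetoid EA renaming (_≈ᵇ_ to _≈ᴬ_; ≈-refl to reflᴬ; ≈-sym to symᴬ; ≈-trans to transᴬ)
  open BoolSetoid EB renaming (_≈ᵇ_ to _≈ᴮ_; ≈-refl to reflᴮ; ≈-sym to symᴮ; ≈-trans to transᴮ)

allFin-enumerates : ∀ n → Enumerates (finSetoid n) (allFin n)
allFin-enumerates n a =
  trans (∑-allFin (λ x → bit (a == x)))
        (trans (∑Fin-cong (λ x → sym (*-identityʳ (bit (a == x))))) (∑Fin-delta a (λ _ → 1)))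

funs-enumerates : ∀ n m → Enumerates (colouringSetoid n m) (funs n m)
funs-enumerates zero m κ = refl
funs-enumerates (suc n) m κ = begin
  ∑ (funs (suc n) m) (λ κ′ → bit (κ ≗ᵇ κ′))
    ≡⟨ ∑-concatMap _ (allFin m) _ ⟩
  ∑ (allFin m) (λ c → ∑ (map _ (funs n m)) (λ κ′ → bit (κ ≗ᵇ κ′)))
    ≡⟨ ∑-cong (allFin m) (λ c → ∑-map _ (funs n m) _) ⟩
  ∑ (allFin m) (λ c → ∑ (funs n m) (λ κ′ → bit ((κ zero == c) ∧ (tail κ ≗ᵇ κ′))))
    ≡⟨ ∑-cong (allFin m) (λ c → ∑-cong (funs n m) (λ κ′ → bit-∧ (κ zero == c) _)) ⟩
  ∑ (allFin m) (λ c → ∑ (funs n m) (λ κ′ → bit (κ zero == c) * bit (tail κ ≗ᵇ κ′)))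
    ≡⟨ ∑-cong (allFin m) (λ c → ∑-*ˡ (funs n m) (bit (κ zero == c)) _) ⟩
  ∑ (allFin m) (λ c → bit (κ zero == c) * ∑ (funs n m) (λ κ′ → bit (tail κ ≗ᵇ κ′)))
    ≡⟨ ∑-cong (allFin m) (λ c → trans (cong (bit (κ zero == c) *_) (funs-enumerates n m (tail κ)))
                                      (*-identityʳ (bit (κ zero == c)))) ⟩
  ∑ (allFin m) (λ c → bit (κ zero == c))
    ≡⟨ allFin-enumerates m (κ zero) ⟩
  1 ∎
  where
  open ≡-Reasoning
  tail : Colouring (suc n) m → Colouring n m
  tail κ x = κ (suc x)

pairs-enumerates : {A B : Set} (EA : BoolSetoid A) (EB : BoolSetoid B) (xs : List A) (ys : List B) →
  Enumerates EA xs → Enumerates EB ys → Enumerates (×-setoid EA EB) (pairs xs ys)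
pairs-enumerates EA EB xs ys enumA enumB (a , b) = begin
  ∑ (pairs xs ys) (λ ab → bit (_≈ᵇ_ (×-setoid EA EB) (a , b) ab))
    ≡⟨ ∑-pairs xs ys _ ⟩
  ∑ xs (λ a′ → ∑ ys (λ b′ → bit ((a ≈ᴬ a′) ∧ (b ≈ᴮ b′))))
    ≡⟨ ∑-cong xs (λ a′ → ∑-cong ys (λ b′ → bit-∧ (a ≈ᴬ a′) _)) ⟩
  ∑ xs (λ a′ → ∑ ys (λ b′ → bit (a ≈ᴬ a′) * bit (b ≈ᴮ b′)))
    ≡⟨ ∑-cong xs (λ a′ → trans (∑-*ˡ ys (bit (a ≈ᴬ a′)) _)
                                (trans (cong (bit (a ≈ᴬ a′) *_) (enumB b)) (*-identityʳ _))) ⟩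
  ∑ xs (λ a′ → bit (a ≈ᴬ a′))
    ≡⟨ enumA a ⟩
  1 ∎
  where
  open ≡-Reasoning
  open BoolSetoid EA renaming (_≈ᵇ_ to _≈ᴬ_)
  open BoolSetoid EB renaming (_≈ᵇ_ to _≈ᴮ_)

adj-sym : ∀ {n} (H : Graph n) x y → adj H x y ≡ adj H y x
adj-sym H x y = cong₂ (λ a b → not a ∧ b) (==-sym x y) (∨-comm (H x y) (H y x))

adj-symm : ∀ {n} (H : Graph n) {x y} → adj H x y ≡ true → adj H y x ≡ true
adj-symm H {x} {y} a = trans (adj-sym H y x) a

adj-irrefl : ∀ {n} (H : Graph n) x → adj H x x ≡ false
adj-irrefl H x rewrite ==-refl x = refl

adj⇒≢ : ∀ {n} (H : Graph n) {x y} → adj H x y ≡ true → x ≢ y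
adj⇒≢ H {x} a refl = true≢false a (adj-irrefl H x)

adj-intro : ∀ {n} (H : Graph n) x y → x ≢ y → H x y ≡ true → adj H x y ≡ true
adj-intro H x y x≢y h = ∧-intro (not-false (==-false x≢y)) (∨-introˡ {H x y} {H y x} h)

deg≥2 : ∀ {n} (H : Graph n) x y z → adj H x y ≡ true → adj H x z ≡ true → y ≢ z → 1 < deg H x
deg≥2 H x y z a b y≢z rewrite count≡∑Fin (adj H x) = ∑Fin-bit≥2 (adj H x) y z a b y≢z

isZero : ∀ {m} → Fin m → Bool
isZero zero = true
isZero (suc _) = false

isZero⇒≡zero : ∀ {m} {c : Fin (suc m)} → isZero c ≡ true → c ≡ zero
isZero⇒≡zero {c = zero} _ = refl

module _ {n m : ℕ} where

  vanishesOff : (Fin n → Bool) → Colouring n m → Bool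
  vanishesOff P κ = ∀ᵇ (λ x → P x ∨ isZero (κ x))

  properOn : Graph n → (Fin n → Bool) → Colouring n m → Bool
  properOn H P κ = ∀ᵇ (λ x → ∀ᵇ (λ y → not ((P x ∧ P y) ∧ adj H x y) ∨ not (κ x == κ y)))

  colourCount : (Fin n → Bool) → Colouring n m → Fin m → ℕ
  colourCount P κ i = ∑Fin (λ x → bit (P x ∧ (κ x == i)))

  content : (Fin n → Bool) → Colouring n m → List ℕ
  content P κ = tabulate (colourCount P κ)

  admissible : Graph n → (Fin n → Bool) → Colouring n m → Bool
  admissible H P κ = vanishesOff P κ ∧ properOn H P κ

  validOn : Graph n → (Fin n → Bool) → List ℕ → Colouring n m → Bool
  validOn H P α κ = admissible H P κ ∧ (content P κ ==ᴸ α)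

  vanishesOff⇒ : ∀ {P κ} → vanishesOff P κ ≡ true → ∀ x → P x ≡ false → isZero (κ x) ≡ true
  vanishesOff⇒ {P} {κ} e x px with ∀ᵇ-elim (λ x → P x ∨ isZero (κ x)) e x
  ... | r rewrite px = r

  ⇒vanishesOff : ∀ {P κ} → (∀ x → P x ≡ false → isZero (κ x) ≡ true) → vanishesOff P κ ≡ true
  ⇒vanishesOff {P} {κ} h = ∀ᵇ-intro _ vanishes
    where
    vanishes : ∀ x → (P x ∨ isZero (κ x)) ≡ true
    vanishes x with P x in px
    ... | true = refl
    ... | false = h x px

  properOn⇒ : ∀ {H P κ} → properOn H P κ ≡ true →
    ∀ x y → P x ≡ true → P y ≡ true → adj H x y ≡ true → (κ x == κ y) ≡ false
  properOn⇒ {H} {P} {κ} e x y px py a =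
    nand⇒ ((P x ∧ P y) ∧ adj H x y) (κ x == κ y) (∀ᵇ-elim _ (∀ᵇ-elim _ e x) y) (∧-intro (∧-intro px py) a)

  ⇒properOn : ∀ {H P κ} → (∀ x y → P x ≡ true → P y ≡ true → adj H x y ≡ true → (κ x == κ y) ≡ false) →
    properOn H P κ ≡ true
  ⇒properOn {H} {P} {κ} h = ∀ᵇ-intro _ (λ x → ∀ᵇ-intro _ (λ y →
    ⇒nand ((P x ∧ P y) ∧ adj H x y) (κ x == κ y)
      (λ e → h x y (∧-elimˡ (∧-elimˡ e)) (∧-elimʳ {P x} (∧-elimˡ e)) (∧-elimʳ {P x ∧ P y} e))))

  properOn-agree : ∀ H P {κ κ′ : Colouring n m} → (∀ x → P x ≡ true → κ x ≡ κ′ x) →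
    properOn H P κ ≡ true → properOn H P κ′ ≡ true
  properOn-agree H P {κ} {κ′} e pr = ⇒properOn {H} {P} {κ′} (λ x y px py a →
    trans (cong₂ _==_ (sym (e x px)) (sym (e y py))) (properOn⇒ {H} {P} {κ} pr x y px py a))

  properOn-mono : ∀ H (P R : Fin n → Bool) {κ : Colouring n m} → (∀ x → P x ≡ true → R x ≡ true) →
    properOn H R κ ≡ true → properOn H P κ ≡ true
  properOn-mono H P R {κ} P⊆R pr = ⇒properOn {H} {P} {κ} (λ x y px py a → properOn⇒ {H} {R} {κ} pr x y (P⊆R x px) (P⊆R y py) a)

  content-length : ∀ P κ → length (content P κ) ≡ m
  content-length P κ = length-tabulate (colourCount P κ)

  content-agree : ∀ P {κ κ′ : Colouring n m} → (∀ x → P x ≡ true → κ x ≡ κ′ x) → content P κ ≡ content P κ′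
  content-agree P {κ} {κ′} e = tabulate-cong (λ i → ∑Fin-cong (agree i))
    where
    agree : ∀ i x → bit (P x ∧ (κ x == i)) ≡ bit (P x ∧ (κ′ x == i))
    agree i x with P x in px
    ... | true = cong (λ c → bit (c == i)) (e x px)
    ... | false = refl

  admissible-cong : ∀ H P {κ κ′ : Colouring n m} → (∀ x → κ x ≡ κ′ x) → admissible H P κ ≡ admissible H P κ′
  admissible-cong H P e =
    cong₂ _∧_ (∀ᵇ-cong (λ x → cong (λ c → P x ∨ isZero c) (e x)))
              (∀ᵇ-cong (λ x → ∀ᵇ-cong (λ y → cong₂ (λ c d → not ((P x ∧ P y) ∧ adj H x y) ∨ not (c == d)) (e x) (e y))))

  validOn-cong : ∀ H P α {κ κ′ : Colouring n m} → (∀ x → κ x ≡ κ′ x) → validOn H P α κ ≡ validOn H P α κ′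
  validOn-cong H P α e = cong₂ _∧_ (admissible-cong H P e) (cong (_==ᴸ α) (content-agree P (λ x _ → e x)))

  validOn-cong-set : ∀ H {P P′ : Fin n → Bool} α (κ : Colouring n m) → (∀ x → P x ≡ P′ x) →
    validOn H P α κ ≡ validOn H P′ α κ
  validOn-cong-set H {P} {P′} α κ e =
    cong₂ _∧_ (cong₂ _∧_ (∀ᵇ-cong (λ x → cong (λ b → b ∨ isZero (κ x)) (e x)))
                         (∀ᵇ-cong (λ x → ∀ᵇ-cong (λ y → cong₂ (λ a b → not ((a ∧ b) ∧ adj H x y) ∨ not (κ x == κ y))
                                                              (e x) (e y)))))
              (cong (_==ᴸ α) (tabulate-cong (λ i → ∑Fin-cong (λ x → cong (λ b → bit (b ∧ (κ x == i))) (e x)))))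

-- Valid colourings take colour zero off P, so XOn counts the proper colourings of the induced
-- subgraph H[P] with content α.
XOn : ∀ {n} (m : ℕ) → Graph n → (Fin n → Bool) → List ℕ → ℕ
XOn {n} m H P α = countIn (validOn {n} {m} H P α) (funs n m)

-- Multiplicativity over separated vertex sets

zipWith-tabulate : ∀ {m} (f g : Fin m → ℕ) → zipWith _+_ (tabulate f) (tabulate g) ≡ tabulate (λ i → f i + g i)
zipWith-tabulate {zero} f g = refl
zipWith-tabulate {suc m} f g = cong (f zero + g zero ∷_) (zipWith-tabulate (λ i → f (suc i)) (λ i → g (suc i)))

module Separated {n m′ : ℕ} (H : Graph n) (P Q : Fin n → Bool) (α : List ℕ)
  (disjoint : ∀ x → P x ≡ true → Q x ≡ false)
  (no-edge : ∀ x y → P x ≡ true → Q y ≡ true → adj H x y ≡ false) where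

  Col : Set
  Col = Colouring n (suc m′)

  P∪Q : Fin n → Bool
  P∪Q x = P x ∨ Q x

  restrict : (Fin n → Bool) → Col → Col
  restrict T κ x = if T x then κ x else zero

  merge : Col × Col → Col
  merge κs x = if P x then proj₁ κs x else proj₂ κs x

  split : Col → Col × Col
  split κ = restrict P κ , restrict Q κ

  validPair : Col × Col → Bool
  validPair κs = (admissible H P (proj₁ κs) ∧ admissible H Q (proj₂ κs))
                 ∧ (zipWith _+_ (content P (proj₁ κs)) (content Q (proj₂ κs)) ==ᴸ α)

  Q⇒¬P : ∀ x → Q x ≡ true → P x ≡ false
  Q⇒¬P x qx with P x in px
  ... | false = refl
  ... | true = ⊥-elim (true≢false qx (disjoint x px))

  content-union : ∀ (κ : Col) → content P∪Q κ ≡ zipWith _+_ (content P κ) (content Q κ)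
  content-union κ =
    trans (tabulate-cong (λ i → trans (∑Fin-cong (split-bit i)) (∑Fin-+ (λ x → bit (P x ∧ (κ x == i))) (λ x → bit (Q x ∧ (κ x == i))))))
          (sym (zipWith-tabulate (colourCount P κ) (colourCount Q κ)))
    where
    split-bit : ∀ i x → bit (P∪Q x ∧ (κ x == i)) ≡ bit (P x ∧ (κ x == i)) + bit (Q x ∧ (κ x == i))
    split-bit i x with P x in px
    ... | true rewrite disjoint x px = sym (+-identityʳ _)
    ... | false = refl

  restrict-agree : ∀ T (κ : Col) x → T x ≡ true → κ x ≡ restrict T κ x
  restrict-agree T κ x tx = sym (if-true (κ x) zero tx)

  restrict-vanishes : ∀ T (κ : Col) → vanishesOff T (restrict T κ) ≡ true
  restrict-vanishes T κ = ⇒vanishesOff {P = T} {κ = restrict T κ} (λ x tx → cong isZero (if-false (κ x) zero tx))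

  merge-P : ∀ (κs : Col × Col) x → P x ≡ true → merge κs x ≡ proj₁ κs x
  merge-P κs x px = if-true (proj₁ κs x) (proj₂ κs x) px

  merge-Q : ∀ (κs : Col × Col) x → Q x ≡ true → merge κs x ≡ proj₂ κs x
  merge-Q κs x qx = if-false (proj₁ κs x) (proj₂ κs x) (Q⇒¬P x qx)

  split-valid : ∀ (κ : Col) → validOn H P∪Q α κ ≡ true → validPair (split κ) ≡ true
  split-valid κ valid = ∧-intro (∧-intro (∧-intro (restrict-vanishes P κ) properP)
                                         (∧-intro (restrict-vanishes Q κ) properQ))
                                contentPQ
    where
    properPQ : properOn H P∪Q κ ≡ true
    properPQ = ∧-elimʳ {vanishesOff P∪Q κ} (∧-elimˡ valid)
    properP : properOn H P (restrict P κ) ≡ true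
    properP = properOn-agree H P (restrict-agree P κ) (properOn-mono H P P∪Q (λ x px → ∨-introˡ px) properPQ)
    properQ : properOn H Q (restrict Q κ) ≡ true
    properQ = properOn-agree H Q (restrict-agree Q κ) (properOn-mono H Q P∪Q (λ x qx → ∨-introʳ {P x} qx) properPQ)
    contentPQ : (zipWith _+_ (content P (restrict P κ)) (content Q (restrict Q κ)) ==ᴸ α) ≡ true
    contentPQ = subst (λ l → (l ==ᴸ α) ≡ true)
      (trans (content-union κ) (cong₂ (zipWith _+_) (content-agree P (restrict-agree P κ))
                                                   (content-agree Q (restrict-agree Q κ))))
      (∧-elimʳ {admissible H P∪Q κ} valid)

  merge-valid : ∀ (κs : Col × Col) → validPair κs ≡ true → validOn H P∪Q α (merge κs) ≡ true
  merge-valid κs valid = ∧-intro (∧-intro vanishes properPQ) contentPQ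
    where
    κ₁ κ₂ : Col
    κ₁ = proj₁ κs
    κ₂ = proj₂ κs
    admissible₁ : admissible H P κ₁ ≡ true
    admissible₁ = ∧-elimˡ (∧-elimˡ valid)
    admissible₂ : admissible H Q κ₂ ≡ true
    admissible₂ = ∧-elimʳ {admissible H P κ₁} (∧-elimˡ valid)
    vanishes : vanishesOff P∪Q (merge κs) ≡ true
    vanishes = ⇒vanishesOff {P = P∪Q} {κ = merge κs} (λ x rx →
      trans (cong isZero (if-false (κ₁ x) (κ₂ x) (∨-falseˡ rx)))
            (vanishesOff⇒ {P = Q} {κ = κ₂} (∧-elimˡ admissible₂) x (∨-falseʳ {P x} rx)))
    properPQ : properOn H P∪Q (merge κs) ≡ true
    properPQ = ⇒properOn {H = H} {P = P∪Q} {κ = merge κs} distinct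
      where
      distinct : ∀ x y → P∪Q x ≡ true → P∪Q y ≡ true → adj H x y ≡ true → (merge κs x == merge κs y) ≡ false
      distinct x y rx ry a with P x in px | P y in py
      ... | true | true = properOn⇒ {H = H} {P = P} {κ = κ₁} (∧-elimʳ {vanishesOff P κ₁} admissible₁) x y px py a
      ... | true | false = ⊥-elim (true≢false a (no-edge x y px ry))
      ... | false | true = ⊥-elim (true≢false (adj-symm H a) (no-edge y x py rx))
      ... | false | false = properOn⇒ {H = H} {P = Q} {κ = κ₂} (∧-elimʳ {vanishesOff Q κ₂} admissible₂) x y rx ry a
    contentPQ : (content P∪Q (merge κs) ==ᴸ α) ≡ true
    contentPQ = subst (λ l → (l ==ᴸ α) ≡ true)
      (sym (trans (content-union (merge κs)) (cong₂ (zipWith _+_) (content-agree P (merge-P κs))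
                                                                  (content-agree Q (merge-Q κs)))))
      (∧-elimʳ {admissible H P κ₁ ∧ admissible H Q κ₂} valid)

  merge-split : ∀ (κ : Col) → validOn H P∪Q α κ ≡ true → ∀ x → merge (split κ) x ≡ κ x
  merge-split κ valid x with P x in px
  ... | true = refl
  ... | false with Q x in qx
  ...   | true = refl
  ...   | false = sym (isZero⇒≡zero (vanishesOff⇒ {P = P∪Q} {κ = κ} (∧-elimˡ (∧-elimˡ valid)) x
                                                 (trans (cong (_∨ Q x) px) qx)))

  split-merge₁ : ∀ (κs : Col × Col) → validPair κs ≡ true → ∀ x → restrict P (merge κs) x ≡ proj₁ κs x
  split-merge₁ κs valid x with P x in px
  ... | true = refl
  ... | false = sym (isZero⇒≡zero (vanishesOff⇒ {P = P} {κ = proj₁ κs} (∧-elimˡ (∧-elimˡ (∧-elimˡ valid))) x px))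

  split-merge₂ : ∀ (κs : Col × Col) → validPair κs ≡ true → ∀ x → restrict Q (merge κs) x ≡ proj₂ κs x
  split-merge₂ κs valid x with Q x in qx
  ... | true = merge-Q κs x qx
  ... | false = sym (isZero⇒≡zero (vanishesOff⇒ {P = Q} {κ = proj₂ κs}
                                     (∧-elimˡ (∧-elimʳ {admissible H P (proj₁ κs)} (∧-elimˡ valid))) x qx))

  colourings : BoolSetoid Col
  colourings = colouringSetoid n (suc m′)

  validPair-resp : ∀ (κs κs′ : Col × Col) → _≈ᵇ_ (×-setoid colourings colourings) κs κs′ ≡ true →
    validPair κs ≡ true → validPair κs′ ≡ true
  validPair-resp κs κs′ e valid =
    subst (_≡ true) (cong₂ _∧_ (cong₂ _∧_ (admissible-cong H P e₁) (admissible-cong H Q e₂))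
                               (cong (_==ᴸ α) (cong₂ (zipWith _+_) (content-agree P (λ x _ → e₁ x))
                                                                  (content-agree Q (λ x _ → e₂ x)))))
          valid
    where
    e₁ : ∀ x → proj₁ κs x ≡ proj₁ κs′ x
    e₁ = ≗ᵇ⇒≗ {κ = proj₁ κs} {proj₁ κs′} (∧-elimˡ e)
    e₂ : ∀ x → proj₂ κs x ≡ proj₂ κs′ x
    e₂ = ≗ᵇ⇒≗ {κ = proj₂ κs} {proj₂ κs′} (∧-elimʳ {proj₁ κs ≗ᵇ proj₁ κs′} e)

  split-correspondence : Correspondence colourings (×-setoid colourings colourings) (validOn H P∪Q α) validPair
  split-correspondence = record
    { to = split
    ; from = λ κs _ → merge κs
    ; p-resp = λ κ κ′ e valid → trans (sym (validOn-cong H P∪Q α (≗ᵇ⇒≗ {κ = κ} {κ′} e))) valid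
    ; q-resp = validPair-resp
    ; to-good = split-valid
    ; from-good = merge-valid
    ; from-to = λ κ valid _ → ≗⇒≗ᵇ {κ = merge (split κ)} {κ} (merge-split κ valid)
    ; to-from = λ κs valid → ∧-intro (≗⇒≗ᵇ {κ = restrict P (merge κs)} {proj₁ κs} (split-merge₁ κs valid))
                                     (≗⇒≗ᵇ {κ = restrict Q (merge κs)} {proj₂ κs} (split-merge₂ κs valid))
    ; to-cong = λ κ κ′ _ e → ∧-intro (restrict-cong P κ κ′ e) (restrict-cong Q κ κ′ e)
    ; from-cong = λ κs κs′ _ _ e → ≗⇒≗ᵇ {κ = merge κs} {merge κs′} (λ x →
        cong₂ (λ c d → if P x then c else d) (≗ᵇ⇒≗ {κ = proj₁ κs} {proj₁ κs′} (∧-elimˡ e) x)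
                                            (≗ᵇ⇒≗ {κ = proj₂ κs} {proj₂ κs′} (∧-elimʳ {proj₁ κs ≗ᵇ proj₁ κs′} e) x))
    }
    where
    restrict-cong : ∀ T κ κ′ → (κ ≗ᵇ κ′) ≡ true → (restrict T κ ≗ᵇ restrict T κ′) ≡ true
    restrict-cong T κ κ′ e = ≗⇒≗ᵇ {κ = restrict T κ} {restrict T κ′}
      (λ x → cong (λ c → if T x then c else zero) (≗ᵇ⇒≗ {κ = κ} {κ′} e x))

  XOn-union : length α ≡ suc m′ →
    XOn (suc m′) H P∪Q α ≡ ∑ (below α) (λ β → XOn (suc m′) H P β * XOn (suc m′) H Q (zipWith _∸_ α β))
  XOn-union lenα =
    trans (count-correspondence (funs n (suc m′)) (pairs (funs n (suc m′)) (funs n (suc m′)))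
            (funs-enumerates n (suc m′))
            (pairs-enumerates colourings colourings (funs n (suc m′)) (funs n (suc m′)) (funs-enumerates n (suc m′)) (funs-enumerates n (suc m′)))
            split-correspondence)
          (sym (count-convolution (funs n (suc m′)) (funs n (suc m′)) (content P) (content Q)
                  (admissible H P) (admissible H Q) α
                  (λ κ → trans (content-length P κ) (sym lenα)) (λ κ → trans (content-length Q κ) (sym lenα))))

full : ∀ {n} → Fin n → Bool
full _ = true

bool-uip : ∀ {a b : Bool} (p q : a ≡ b) → p ≡ q
bool-uip refl refl = refl

colourCount≡countIn : ∀ {n m} (P : Fin n → Bool) (κ : Colouring n m) i →
  colourCount P κ i ≡ countIn (λ x → P x ∧ (κ x == i)) (allFin n)
colourCount≡countIn {n} P κ i =
  sym (trans (countIn≡∑ (λ x → P x ∧ (κ x == i)) (allFin n)) (∑-allFin (λ x → bit (P x ∧ (κ x == i)))))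

module InducedIsomorphism {n k m′ : ℕ} (H : Graph n) (H′ : Graph k) (P : Fin n → Bool)
  (embed : Fin k → Fin n) (index : (x : Fin n) → P x ≡ true → Fin k)
  (embed-in : ∀ y → P (embed y) ≡ true)
  (embed-index : ∀ x px → embed (index x px) ≡ x)
  (index-embed : ∀ y px → index (embed y) px ≡ y)
  (embed-adj : ∀ y y′ → adj H′ y y′ ≡ adj H (embed y) (embed y′))
  (α : List ℕ) where

  m : ℕ
  m = suc m′

  index-irrelevant : ∀ x x′ px px′ → x ≡ x′ → index x px ≡ index x′ px′
  index-irrelevant x .x px px′ refl = cong (index x) (bool-uip px px′)

  content-pullback : ∀ (κ : Colouring n m) → content full (λ y → κ (embed y)) ≡ content P κ
  content-pullback κ = tabulate-cong (λ i →
    trans (colourCount≡countIn full κ′ i) (trans (count-correspondence (allFin k) (allFin n)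
      (allFin-enumerates k) (allFin-enumerates n) (fibres i)) (sym (colourCount≡countIn P κ i))))
    where
    κ′ : Colouring k m
    κ′ y = κ (embed y)
    fibres : ∀ i → Correspondence (finSetoid k) (finSetoid n) (λ y → full y ∧ (κ′ y == i)) (λ x → P x ∧ (κ x == i))
    fibres i = record
      { to = embed
      ; from = λ x q → index x (∧-elimˡ q)
      ; p-resp = λ y y′ e p → subst (λ z → (κ′ z == i) ≡ true) (==⇒≡ e) p
      ; q-resp = λ x x′ e q → subst (λ z → (P z ∧ (κ z == i)) ≡ true) (==⇒≡ e) q
      ; to-good = λ y p → ∧-intro (embed-in y) p
      ; from-good = λ x q → subst (λ z → (κ z == i) ≡ true) (sym (embed-index x (∧-elimˡ q))) (∧-elimʳ {P x} q)
      ; from-to = λ y _ q → ==-true (index-embed y (∧-elimˡ q))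
      ; to-from = λ x q → ==-true (embed-index x (∧-elimˡ q))
      ; to-cong = λ y y′ _ e → ==-true (cong embed (==⇒≡ e))
      ; from-cong = λ x x′ q q′ e → ==-true (index-irrelevant x x′ (∧-elimˡ q) (∧-elimˡ q′) (==⇒≡ e))
      }

  pullback : Colouring n m → Colouring k m
  pullback κ y = κ (embed y)

  extendAt : Colouring k m → (x : Fin n) → (b : Bool) → P x ≡ b → Fin m
  extendAt κ′ x true px = κ′ (index x px)
  extendAt κ′ x false _ = zero

  extend : Colouring k m → Colouring n m
  extend κ′ x = extendAt κ′ x (P x) refl

  extend-in : ∀ κ′ x (px : P x ≡ true) → extend κ′ x ≡ κ′ (index x px)
  extend-in κ′ x px = at (P x) refl
    where
    at : ∀ b (e : P x ≡ b) → extendAt κ′ x b e ≡ κ′ (index x px)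
    at true e = cong (λ z → κ′ (index x z)) (bool-uip e px)
    at false e = ⊥-elim (true≢false px e)

  extend-out : ∀ κ′ x → P x ≡ false → extend κ′ x ≡ zero
  extend-out κ′ x px = at (P x) refl
    where
    at : ∀ b (e : P x ≡ b) → extendAt κ′ x b e ≡ zero
    at true e = ⊥-elim (true≢false e px)
    at false e = refl

  pullback-extend : ∀ κ′ y → pullback (extend κ′) y ≡ κ′ y
  pullback-extend κ′ y = trans (extend-in κ′ (embed y) (embed-in y)) (cong κ′ (index-embed y (embed-in y)))

  pullback-valid : ∀ κ → validOn H P α κ ≡ true → validOn H′ full α (pullback κ) ≡ true
  pullback-valid κ valid = ∧-intro (∧-intro vanishes properFull) contentFull
    where
    vanishes : vanishesOff full (pullback κ) ≡ true
    vanishes = ⇒vanishesOff {P = full} {κ = pullback κ} (λ y ())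
    properFull : properOn H′ full (pullback κ) ≡ true
    properFull = ⇒properOn {H = H′} {P = full} {κ = pullback κ} (λ y y′ _ _ a →
      properOn⇒ {H = H} {P = P} {κ = κ} (∧-elimʳ {vanishesOff P κ} (∧-elimˡ valid))
                (embed y) (embed y′) (embed-in y) (embed-in y′) (trans (sym (embed-adj y y′)) a))
    contentFull : (content full (pullback κ) ==ᴸ α) ≡ true
    contentFull = subst (λ l → (l ==ᴸ α) ≡ true) (sym (content-pullback κ)) (∧-elimʳ {admissible H P κ} valid)

  extend-valid : ∀ κ′ → validOn H′ full α κ′ ≡ true → validOn H P α (extend κ′) ≡ true
  extend-valid κ′ valid = ∧-intro (∧-intro vanishes properP) contentP
    where
    vanishes : vanishesOff P (extend κ′) ≡ true
    vanishes = ⇒vanishesOff {P = P} {κ = extend κ′} (λ x px → cong isZero (extend-out κ′ x px))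
    properP : properOn H P (extend κ′) ≡ true
    properP = ⇒properOn {H = H} {P = P} {κ = extend κ′} (λ x x′ px px′ a →
      trans (cong₂ _==_ (extend-in κ′ x px) (extend-in κ′ x′ px′))
        (properOn⇒ {H = H′} {P = full} {κ = κ′} (∧-elimʳ {vanishesOff full κ′} (∧-elimˡ valid))
                   (index x px) (index x′ px′) refl refl
                   (trans (embed-adj (index x px) (index x′ px′))
                          (trans (cong₂ (adj H) (embed-index x px) (embed-index x′ px′)) a))))
    contentP : (content P (extend κ′) ==ᴸ α) ≡ true
    contentP = subst (λ l → (l ==ᴸ α) ≡ true)
      (trans (content-agree full (λ y _ → sym (pullback-extend κ′ y))) (content-pullback (extend κ′)))
      (∧-elimʳ {admissible H′ full κ′} valid)

  extend-pullback : ∀ κ → validOn H P α κ ≡ true → ∀ x → extend (pullback κ) x ≡ κ x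
  extend-pullback κ valid x = at (P x) refl
    where
    at : ∀ b → P x ≡ b → extend (pullback κ) x ≡ κ x
    at true px = trans (extend-in (pullback κ) x px) (cong κ (embed-index x px))
    at false px = trans (extend-out (pullback κ) x px)
                        (sym (isZero⇒≡zero (vanishesOff⇒ {P = P} {κ = κ} (∧-elimˡ (∧-elimˡ valid)) x px)))

  extend-cong : ∀ κ′ κ″ → (∀ y → κ′ y ≡ κ″ y) → ∀ x → extend κ′ x ≡ extend κ″ x
  extend-cong κ′ κ″ e x = at (P x) refl
    where
    at : ∀ b → P x ≡ b → extend κ′ x ≡ extend κ″ x
    at true px = trans (extend-in κ′ x px) (trans (e _) (sym (extend-in κ″ x px)))
    at false px = trans (extend-out κ′ x px) (sym (extend-out κ″ x px))

  XOn-induced : XOn m H P α ≡ XOn m H′ full α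
  XOn-induced = count-correspondence {EA = colouringSetoid n m} {colouringSetoid k m}
    (funs n m) (funs k m) (funs-enumerates n m) (funs-enumerates k m) (record
    { to = pullback
    ; from = λ κ′ _ → extend κ′
    ; p-resp = λ κ κ′ e valid → trans (sym (validOn-cong H P α (≗ᵇ⇒≗ {κ = κ} {κ′} e))) valid
    ; q-resp = λ κ κ′ e valid → trans (sym (validOn-cong H′ full α (≗ᵇ⇒≗ {κ = κ} {κ′} e))) valid
    ; to-good = pullback-valid
    ; from-good = extend-valid
    ; from-to = λ κ valid _ → ≗⇒≗ᵇ {κ = extend (pullback κ)} {κ} (extend-pullback κ valid)
    ; to-from = λ κ′ _ → ≗⇒≗ᵇ {κ = pullback (extend κ′)} {κ′} (pullback-extend κ′)
    ; to-cong = λ κ κ′ _ e → ≗⇒≗ᵇ {κ = pullback κ} {pullback κ′} (λ y → ≗ᵇ⇒≗ {κ = κ} {κ′} e (embed y))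
    ; from-cong = λ κ′ κ″ _ _ e → ≗⇒≗ᵇ {κ = extend κ′} {extend κ″} (extend-cong κ′ κ″ (≗ᵇ⇒≗ {κ = κ′} {κ″} e))
    })

none : ∀ {n} → Fin n → Bool
none _ = false

∀ᵇ-true : ∀ {n} → ∀ᵇ {n} (λ _ → true) ≡ true
∀ᵇ-true {n} = ∀ᵇ-intro {n} (λ _ → true) (λ _ → refl)

tabulate-==ᴸ : ∀ α (h : Fin (length α) → ℕ) → (tabulate h ==ᴸ α) ≡ ∀ᵇ (λ i → h i ≡ᵇ lookup α i)
tabulate-==ᴸ [] h = refl
tabulate-==ᴸ (a ∷ α) h = cong ((h zero ≡ᵇ a) ∧_) (tabulate-==ᴸ α (λ i → h (suc i)))

X≡XOn-full : ∀ {n} (H : Graph n) α → X H α ≡ ℤ.+ XOn (length α) H full α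
X≡XOn-full {n} H α = cong ℤ.+_ (countIn-cong (funs n (length α)) same)
  where
  same : ∀ κ → (proper H κ ∧ hasContent α κ) ≡ validOn H full α κ
  same κ = cong₂ _∧_
    (trans (trans (all-allFin (λ x → all (λ y → not (adj H x y) ∨ not (κ x == κ y)) (allFin n)))
                  (∀ᵇ-cong (λ x → all-allFin (λ y → not (adj H x y) ∨ not (κ x == κ y)))))
           (sym (cong (_∧ properOn H full κ) (∀ᵇ-true {n}))))
    (sym (trans (tabulate-==ᴸ α (colourCount full κ))
           (trans (∀ᵇ-cong (λ i → cong (_≡ᵇ lookup α i) (sym (count≡∑Fin (λ x → κ x == i)))))
                  (sym (all-allFin (λ i → count (λ x → κ x == i) ≡ᵇ lookup α i))))))

isZero≡zero== : ∀ {m} (c : Fin (suc m)) → isZero c ≡ (zero == c)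
isZero≡zero== zero = refl
isZero≡zero== (suc c) = refl

zeros-==ᴸ : ∀ α → (tabulate {n = length α} (λ _ → 0) ==ᴸ α) ≡ all (λ a → a ≡ᵇ 0) α
zeros-==ᴸ [] = refl
zeros-==ᴸ (zero ∷ α) = zeros-==ᴸ α
zeros-==ᴸ (suc a ∷ α) = refl

oneS≡bit : ∀ α → oneS α ≡ ℤ.+ bit (all (λ a → a ≡ᵇ 0) α)
oneS≡bit α with all (λ a → a ≡ᵇ 0) α
... | true = refl
... | false = refl

XOn-none : ∀ {n} (H : Graph n) α → 0 < length α → ℤ.+ XOn (length α) H none α ≡ oneS α
XOn-none {n} H (a ∷ α′) _ = begin
  ℤ.+ countIn (validOn H none α) (funs n m)
    ≡⟨ cong ℤ.+_ (countIn-cong (funs n m) only-zero) ⟩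
  ℤ.+ countIn (λ κ → (zeroColouring ≗ᵇ κ) ∧ allZero) (funs n m)
    ≡⟨ cong ℤ.+_ (countIn≡∑ _ (funs n m)) ⟩
  ℤ.+ ∑ (funs n m) (λ κ → bit ((zeroColouring ≗ᵇ κ) ∧ allZero))
    ≡⟨ cong ℤ.+_ (∑-cong (funs n m) (λ κ → trans (bit-∧ (zeroColouring ≗ᵇ κ) allZero) (*-comm _ (bit allZero)))) ⟩
  ℤ.+ ∑ (funs n m) (λ κ → bit allZero * bit (zeroColouring ≗ᵇ κ))
    ≡⟨ cong ℤ.+_ (∑-*ˡ (funs n m) (bit allZero) _) ⟩
  ℤ.+ (bit allZero * ∑ (funs n m) (λ κ → bit (zeroColouring ≗ᵇ κ)))
    ≡⟨ cong (λ z → ℤ.+ (bit allZero * z)) (funs-enumerates n m zeroColouring) ⟩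
  ℤ.+ (bit allZero * 1)
    ≡⟨ cong ℤ.+_ (*-identityʳ _) ⟩
  ℤ.+ bit allZero
    ≡⟨ sym (oneS≡bit α) ⟩
  oneS α ∎
  where
  open ≡-Reasoning
  α : List ℕ
  α = a ∷ α′
  m : ℕ
  m = length α
  allZero : Bool
  allZero = all (λ a → a ≡ᵇ 0) α
  zeroColouring : Colouring n m
  zeroColouring _ = zero
  only-zero : ∀ κ → validOn H none α κ ≡ ((zeroColouring ≗ᵇ κ) ∧ allZero)
  only-zero κ = cong₂ _∧_
    (trans (cong₂ _∧_ (∀ᵇ-cong (λ x → isZero≡zero== (κ x)))
                      (trans (∀ᵇ-cong {n} (λ x → ∀ᵇ-true {n})) (∀ᵇ-true {n})))
           (∧-identityʳ _))
    (trans (cong (_==ᴸ α) (tabulate-cong (λ i → ∑Fin-zero (λ x → bit (false ∧ (κ x == i))) (λ _ → refl))))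
           (zeros-==ᴸ α))

-- Graphs without internal edges are star forests

NoInternalEdge : ∀ {n} → Graph n → Set
NoInternalEdge H = ∀ u v → ¬ Internal H u v

any-elim : ∀ {A : Set} (p : A → Bool) (xs : List A) → any p xs ≡ true → Σ A (λ x → p x ≡ true)
any-elim p (x ∷ xs) e with p x in px
... | true = x , px
... | false = any-elim p xs e

any-tabulate : ∀ {k} {A : Set} (h : Fin k → A) (p : A → Bool) (z : Fin k) → p (h z) ≡ true → any p (tabulate h) ≡ true
any-tabulate h p zero e rewrite e = refl
any-tabulate h p (suc z) e = ∨-introʳ {p (h zero)} (any-tabulate (λ i → h (suc i)) p z e)

any-allFin : ∀ {n} (p : Fin n → Bool) z → p z ≡ true → any p (allFin n) ≡ true
any-allFin p z e = any-tabulate (λ i → i) p z e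

any-false : ∀ {A : Set} (p : A → Bool) xs → (∀ x → p x ≡ false) → any p xs ≡ false
any-false p [] h = refl
any-false p (x ∷ xs) h rewrite h x = any-false p xs h

reach-≤′ : ∀ {n} (H : Graph n) {k} k′ x y → k ≤′ k′ → reach H k x y ≡ true → reach H k′ x y ≡ true
reach-≤′ H k′ x y (≤′-reflexive refl) e = e
reach-≤′ H (suc k′) x y (≤′-step k≤′k′) e = ∨-introˡ (reach-≤′ H k′ x y k≤′k′ e)

reach-adj : ∀ {n} (H : Graph n) x y → adj H x y ≡ true → reach H 1 x y ≡ true
reach-adj H x y a = ∨-introʳ {x == y} (any-allFin (λ z → (x == z) ∧ adj H z y) x (∧-intro (==-refl x) a))

reach-adj² : ∀ {n} (H : Graph n) x z y → adj H x z ≡ true → adj H z y ≡ true → reach H 2 x y ≡ true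
reach-adj² H x z y a b =
  ∨-introʳ {reach H 1 x y} (any-allFin (λ w → reach H 1 x w ∧ adj H w y) z (∧-intro (reach-adj H x z a) b))

two-vertices : ∀ {n} {x y : Fin n} → x ≢ y → 2 ≤ n
two-vertices {x = zero} {zero} x≢y = ⊥-elim (x≢y refl)
two-vertices {x = zero} {suc zero} x≢y = s≤s (s≤s z≤n)
two-vertices {x = zero} {suc (suc y)} x≢y = s≤s (s≤s z≤n)
two-vertices {x = suc zero} {y} x≢y = s≤s (s≤s z≤n)
two-vertices {x = suc (suc x)} {y} x≢y = s≤s (s≤s z≤n)

module WithoutInternalEdges {n : ℕ} (H : Graph n) (noInternal : NoInternalEdge H) where

  pendant : ∀ x y → adj H x y ≡ true → 1 < deg H x → ∀ w → adj H y w ≡ true → w ≡ x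
  pendant x y a dx w b with w ≟ x
  ... | yes w≡x = w≡x
  ... | no w≢x = ⊥-elim (noInternal x y (a , dx , deg≥2 H y x w (adj-symm H a) b (λ e → w≢x (sym e))))

  -- Without internal edges every component has diameter at most two.
  Near : Fin n → Fin n → Set
  Near x y = (x ≡ y) ⊎ (adj H x y ≡ true) ⊎ Σ (Fin n) (λ z → (adj H x z ≡ true) × (adj H z y ≡ true))

  near-step : ∀ {x z y} → Near x z → adj H z y ≡ true → Near x y
  near-step (inj₁ refl) a = inj₂ (inj₁ a)
  near-step {x} {z} {y} (inj₂ (inj₁ axz)) a with x ≟ y
  ... | yes x≡y = inj₁ x≡y
  ... | no _ = inj₂ (inj₂ (z , axz , a))
  near-step {x} {z} {y} (inj₂ (inj₂ (w , axw , awz))) a with y ≟ w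
  ... | yes refl = inj₂ (inj₁ axw)
  ... | no y≢w with pendant z w (adj-symm H awz) (deg≥2 H z w y (adj-symm H awz) a (λ e → y≢w (sym e))) x (adj-symm H axw)
  ...   | refl = inj₂ (inj₁ a)

  near-sym : ∀ {x y} → Near x y → Near y x
  near-sym (inj₁ e) = inj₁ (sym e)
  near-sym (inj₂ (inj₁ a)) = inj₂ (inj₁ (adj-symm H a))
  near-sym (inj₂ (inj₂ (z , a , b))) = inj₂ (inj₂ (z , adj-symm H b , adj-symm H a))

  near-trans : ∀ {x y w} → Near x y → Near y w → Near x w
  near-trans d (inj₁ refl) = d
  near-trans d (inj₂ (inj₁ a)) = near-step d a
  near-trans d (inj₂ (inj₂ (z , a , b))) = near-step (near-step d a) b

  reach⇒near : ∀ k x y → reach H k x y ≡ true → Near x y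
  reach⇒near zero x y e = inj₁ (==⇒≡ e)
  reach⇒near (suc k) x y e with ∨-elim {reach H k x y} e
  ... | inj₁ r = reach⇒near k x y r
  ... | inj₂ r with any-elim _ (allFin n) r
  ...   | z , pz = near-step (reach⇒near k x z (∧-elimˡ pz)) (∧-elimʳ {reach H k x z} pz)

  near⇒conn : ∀ x y → Near x y → conn H x y ≡ true
  near⇒conn x .x (inj₁ refl) = reach-≤′ H n x x (≤⇒≤′ z≤n) (==-refl x)
  near⇒conn x y (inj₂ (inj₁ a)) =
    reach-≤′ H n x y (≤⇒≤′ (≤-trans (s≤s z≤n) (two-vertices (adj⇒≢ H a)))) (reach-adj H x y a)
  near⇒conn x y (inj₂ (inj₂ (z , a , b))) =
    reach-≤′ H n x y (≤⇒≤′ (two-vertices (adj⇒≢ H a))) (reach-adj² H x z y a b)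

  conn⇒near : ∀ x y → conn H x y ≡ true → Near x y
  conn⇒near x y e = reach⇒near n x y e

  conn-refl : ∀ x → conn H x x ≡ true
  conn-refl x = near⇒conn x x (inj₁ refl)

  conn-sym : ∀ x y → conn H x y ≡ true → conn H y x ≡ true
  conn-sym x y e = near⇒conn y x (near-sym (conn⇒near x y e))

  conn-trans : ∀ x y w → conn H x y ≡ true → conn H y w ≡ true → conn H x w ≡ true
  conn-trans x y w e f = near⇒conn x w (near-trans (conn⇒near x y e) (conn⇒near y w f))

  conn-adj : ∀ x y → adj H x y ≡ true → conn H x y ≡ true
  conn-adj x y a = near⇒conn x y (inj₂ (inj₁ a))

  IsCentre : Fin n → Set
  IsCentre c = ∀ w → adj H c w ≡ true → ∀ v → adj H w v ≡ true → v ≡ c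

  Closed : Fin n → Fin n → Set
  Closed c y = (y ≡ c) ⊎ (adj H c y ≡ true)

  other-neighbour : ∀ x y z → adj H x y ≡ true → (adj H x z ∧ not (z == y)) ≡ true → 1 < deg H x
  other-neighbour x y z a e =
    deg≥2 H x y z a (∧-elimˡ e) (λ y≡z → true≢false (==-true (sym y≡z)) (not-true (∧-elimʳ {adj H x z} e)))

  only-neighbour : ∀ x y → (∀ z → (adj H x z ∧ not (z == y)) ≡ false) → ∀ w → adj H x w ≡ true → w ≡ y
  only-neighbour x y h w b with w ≟ y
  ... | yes w≡y = w≡y
  ... | no w≢y = ⊥-elim (true≢false (∧-intro b (not-false (==-false w≢y))) (h w))

  centre : ∀ x → Σ (Fin n) (λ c → IsCentre c × Closed c x)
  centre x with search (adj H x)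
  ... | inj₂ isolated = x , (λ w a → ⊥-elim (true≢false a (isolated w))) , inj₁ refl
  ... | inj₁ (y , axy) with search (λ z → adj H x z ∧ not (z == y))
  ...   | inj₁ (z , e) = x , (λ w a → pendant x w a (other-neighbour x y z axy e)) , inj₁ refl
  ...   | inj₂ only-y with search (λ z → adj H y z ∧ not (z == x))
  ...     | inj₁ (z , e) = y , (λ w a → pendant y w a (other-neighbour y x z (adj-symm H axy) e)) , inj₂ (adj-symm H axy)
  ...     | inj₂ only-x = x , isolated-edge , inj₁ refl
    where
    isolated-edge : IsCentre x
    isolated-edge w a v b with only-neighbour x y only-y w a
    ... | refl = only-neighbour y x only-x v b

  module Star (c : Fin n) (isCentre : IsCentre c) where

    closed⇒near : ∀ {y} → Closed c y → Near c y
    closed⇒near (inj₁ refl) = inj₁ refl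
    closed⇒near (inj₂ a) = inj₂ (inj₁ a)

    near⇒closed : ∀ {y} → Near c y → Closed c y
    near⇒closed (inj₁ refl) = inj₁ refl
    near⇒closed (inj₂ (inj₁ a)) = inj₂ a
    near⇒closed (inj₂ (inj₂ (z , a , b))) = inj₁ (isCentre z a _ b)

    component⊆closed : ∀ {x y} → Closed c x → conn H x y ≡ true → Closed c y
    component⊆closed cx e = near⇒closed (near-trans (closed⇒near cx) (conn⇒near _ _ e))

    closed⊆component : ∀ {x y} → Closed c x → Closed c y → conn H x y ≡ true
    closed⊆component cx cy = near⇒conn _ _ (near-trans (near-sym (closed⇒near cx)) (closed⇒near cy))

    star-adj⇒ : ∀ {y z} → Closed c y → Closed c z → y ≢ z → adj H y z ≡ true → (y ≡ c) ⊎ (z ≡ c)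
    star-adj⇒ (inj₁ e) cz y≢z a = inj₁ e
    star-adj⇒ (inj₂ b) (inj₁ e) y≢z a = inj₂ e
    star-adj⇒ (inj₂ b) (inj₂ b′) y≢z a = inj₂ (isCentre _ b _ a)

    star-adj⇐ : ∀ {y z} → Closed c y → Closed c z → y ≢ z → (y ≡ c) ⊎ (z ≡ c) → adj H y z ≡ true
    star-adj⇐ cy (inj₁ refl) y≢z (inj₁ refl) = ⊥-elim (y≢z refl)
    star-adj⇐ cy (inj₂ b) y≢z (inj₁ refl) = b
    star-adj⇐ (inj₁ refl) cz y≢z (inj₂ refl) = ⊥-elim (y≢z refl)
    star-adj⇐ (inj₂ b) cz y≢z (inj₂ refl) = adj-symm H b

  isStarForest : IsStarForest H
  isStarForest x with centre x
  ... | c , isCentre , cx = c , closed⊆component cx (inj₁ refl) , λ y z ey ez y≢z →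
        mk⇔ (star-adj⇒ (component⊆closed cx ey) (component⊆closed cx ez) y≢z)
            (star-adj⇐ (component⊆closed cx ey) (component⊆closed cx ez) y≢z)
    where
    open Star c isCentre

sucIf : Bool → ℕ → ℕ
sucIf true k = suc k
sucIf false k = k

card : ∀ {n} → (Fin n → Bool) → ℕ
card {zero} P = 0
card {suc n} P = sucIf (P zero) (card (λ x → P (suc x)))

card≡count : ∀ {n} (P : Fin n → Bool) → card P ≡ count P
card≡count P = trans (card≡∑Fin P) (sym (count≡∑Fin P))
  where
  card≡∑Fin : ∀ {n} (P : Fin n → Bool) → card P ≡ ∑Fin (λ x → bit (P x))
  card≡∑Fin {zero} P = refl
  card≡∑Fin {suc n} P with P zero
  ... | true = cong suc (card≡∑Fin (λ x → P (suc x)))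
  ... | false = card≡∑Fin (λ x → P (suc x))

elementStep : ∀ {k n} (b : Bool) → (Fin k → Fin n) → Fin (sucIf b k) → Fin (suc n)
elementStep true e zero = zero
elementStep true e (suc i) = suc (e i)
elementStep false e i = suc (e i)

positionStep : ∀ {k} (b : Bool) → Fin k → Fin (sucIf b k)
positionStep true i = suc i
positionStep false i = i

firstPosition : ∀ {k} (b : Bool) → b ≡ true → Fin (sucIf b k)
firstPosition true _ = zero

element : ∀ {n} (P : Fin n → Bool) → Fin (card P) → Fin n
element {suc n} P = elementStep (P zero) (element (λ x → P (suc x)))

position : ∀ {n} (P : Fin n → Bool) (x : Fin n) → P x ≡ true → Fin (card P)
position {suc n} P zero px = firstPosition (P zero) px
position {suc n} P (suc x) px = positionStep (P zero) (position (λ y → P (suc y)) x px)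

element-in : ∀ {n} (P : Fin n → Bool) i → P (element P i) ≡ true
element-in {suc n} P i = step (P zero) refl i
  where
  step : ∀ b → P zero ≡ b → (i : Fin (sucIf b (card (λ x → P (suc x))))) →
    P (elementStep b (element (λ x → P (suc x))) i) ≡ true
  step true e zero = e
  step true e (suc i) = element-in (λ x → P (suc x)) i
  step false e i = element-in (λ x → P (suc x)) i

element-position : ∀ {n} (P : Fin n → Bool) x px → element P (position P x px) ≡ x
element-position {suc n} P zero px = step (P zero) px
  where
  step : ∀ b (e : b ≡ true) → elementStep {k = card (λ x → P (suc x))} b (element (λ x → P (suc x))) (firstPosition b e) ≡ zero
  step true e = refl
element-position {suc n} P (suc x) px = step (P zero)
  where
  step : ∀ b → elementStep b (element (λ x → P (suc x))) (positionStep b (position (λ y → P (suc y)) x px)) ≡ suc x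
  step true = cong suc (element-position (λ y → P (suc y)) x px)
  step false = cong suc (element-position (λ y → P (suc y)) x px)

element-injective : ∀ {n} (P : Fin n → Bool) i j → element P i ≡ element P j → i ≡ j
element-injective {suc n} P i j e = step (P zero) i j e
  where
  Q : Fin n → Bool
  Q x = P (suc x)
  step : ∀ b (i j : Fin (sucIf b (card Q))) → elementStep b (element Q) i ≡ elementStep b (element Q) j → i ≡ j
  step true zero zero e = refl
  step true (suc i) (suc j) e = cong suc (element-injective Q i j (Fin.suc-injective e))
  step false i j e = element-injective Q i j (Fin.suc-injective e)

position-element : ∀ {n} (P : Fin n → Bool) i px → position P (element P i) px ≡ i
position-element P i px = element-injective P _ i (element-position P (element P i) px)

transpose-source : ∀ {k} (i j : Fin k) → PC.transpose i j i ≡ j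
transpose-source i j rewrite dec-true (i ≟ i) refl = refl

zeroOf : ∀ {k} → Fin k → Fin k
zeroOf {suc k} _ = zero

module StarComponent {n : ℕ} (H : Graph n) (noInternal : NoInternalEdge H) (r : Fin n) where
  open WithoutInternalEdges H noInternal

  component : Fin n → Bool
  component = conn H r

  c : Fin n
  c = proj₁ (centre r)

  open Star c (proj₁ (proj₂ (centre r)))

  in-component⇒closed : ∀ x → component x ≡ true → Closed c x
  in-component⇒closed x px = component⊆closed (proj₂ (proj₂ (centre r))) px

  c-in : component c ≡ true
  c-in = closed⊆component (proj₂ (proj₂ (centre r))) (inj₁ refl)

  k : ℕ
  k = card component

  j : Fin k
  j = position component c c-in

  -- The component, listed with its centre moved to position 0, the centre of starGraph k.
  embed : Fin k → Fin n
  embed y = element component (PC.transpose (zeroOf j) j y)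

  index : (x : Fin n) → component x ≡ true → Fin k
  index x px = PC.transpose j (zeroOf j) (position component x px)

  embed-in : ∀ y → component (embed y) ≡ true
  embed-in y = element-in component (PC.transpose (zeroOf j) j y)

  embed-index : ∀ x px → embed (index x px) ≡ x
  embed-index x px = trans (cong (element component) (PC.transpose-inverse (zeroOf j) j))
                           (element-position component x px)

  index-embed : ∀ y px → index (embed y) px ≡ y
  index-embed y px = trans (cong (PC.transpose j (zeroOf j)) (position-element component _ px))
                           (PC.transpose-inverse j (zeroOf j))

  embed-injective : ∀ y y′ → embed y ≡ embed y′ → y ≡ y′
  embed-injective y y′ e =
    trans (sym (PC.transpose-inverse j (zeroOf j)))
          (trans (cong (PC.transpose j (zeroOf j)) (element-injective component _ _ e))
                 (PC.transpose-inverse j (zeroOf j)))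

  embed≡c⇒ : ∀ y → embed y ≡ c → y ≡ zeroOf j
  embed≡c⇒ y e = begin
    y                                                      ≡⟨ sym (PC.transpose-inverse j (zeroOf j)) ⟩
    PC.transpose j (zeroOf j) (PC.transpose (zeroOf j) j y) ≡⟨ cong (PC.transpose j (zeroOf j)) centre-position ⟩
    PC.transpose j (zeroOf j) j                             ≡⟨ transpose-source j (zeroOf j) ⟩
    zeroOf j                                               ∎
    where
    open ≡-Reasoning
    centre-position : PC.transpose (zeroOf j) j y ≡ j
    centre-position = element-injective component _ _ (trans e (sym (element-position component c c-in)))

  ⇒embed≡c : ∀ y → y ≡ zeroOf j → embed y ≡ c
  ⇒embed≡c y refl = trans (cong (element component) (transpose-source (zeroOf j) j)) (element-position component c c-in)

  adj-in-star : ∀ a a′ → Closed c a → Closed c a′ → adj H a a′ ≡ (not (a == a′) ∧ ((a == c) ∨ (a′ == c)))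
  adj-in-star a a′ ca ca′ with toSum (a ≟ a′)
  ... | inj₁ refl = trans (adj-irrefl H a) (cong (λ b → not b ∧ ((a == c) ∨ (a == c))) (sym (==-refl a)))
  ... | inj₂ a≢a′ = trans (≡true-⇔ to from) (cong (λ b → not b ∧ ((a == c) ∨ (a′ == c))) (sym (==-false a≢a′)))
    where
    to : adj H a a′ ≡ true → ((a == c) ∨ (a′ == c)) ≡ true
    to a~a′ with star-adj⇒ ca ca′ a≢a′ a~a′
    ... | inj₁ a≡c = ∨-introˡ (==-true a≡c)
    ... | inj₂ a′≡c = ∨-introʳ {a == c} (==-true a′≡c)
    from : ((a == c) ∨ (a′ == c)) ≡ true → adj H a a′ ≡ true
    from o with ∨-elim {a == c} o
    ... | inj₁ a≡c = star-adj⇐ ca ca′ a≢a′ (inj₁ (==⇒≡ a≡c))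
    ... | inj₂ a′≡c = star-adj⇐ ca ca′ a≢a′ (inj₂ (==⇒≡ a′≡c))

  embed-adj : ∀ y y′ → adj (starGraph k) y y′ ≡ adj H (embed y) (embed y′)
  embed-adj y y′ = begin
    adj (starGraph k) y y′
      ≡⟨ cong (λ b → not (y == y′) ∧ b) (∨-idem (toℕ y ≡ᵇ 0) (toℕ y′ ≡ᵇ 0)) ⟩
    not (y == y′) ∧ ((toℕ y ≡ᵇ 0) ∨ (toℕ y′ ≡ᵇ 0))
      ≡⟨ cong₂ (λ u v → not u ∧ v) same-vertex (cong₂ _∨_ (is-centre y) (is-centre y′)) ⟩
    not (embed y == embed y′) ∧ ((embed y == c) ∨ (embed y′ == c))
      ≡⟨ sym (adj-in-star (embed y) (embed y′) (in-component⇒closed _ (embed-in y)) (in-component⇒closed _ (embed-in y′))) ⟩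
    adj H (embed y) (embed y′) ∎
    where
    open ≡-Reasoning
    ∨-idem : ∀ p q → ((p ∨ q) ∨ (q ∨ p)) ≡ (p ∨ q)
    ∨-idem true q = refl
    ∨-idem false true = refl
    ∨-idem false false = refl
    toℕ≡0 : ∀ {k} (j y : Fin k) → (toℕ y ≡ᵇ 0) ≡ (y == zeroOf j)
    toℕ≡0 {suc k} j zero = refl
    toℕ≡0 {suc k} j (suc y) = refl
    same-vertex : (y == y′) ≡ (embed y == embed y′)
    same-vertex = ≡true-⇔ (λ e → ==-true (cong embed (==⇒≡ e))) (λ e → ==-true (embed-injective y y′ (==⇒≡ e)))
    is-centre : ∀ z → (toℕ z ≡ᵇ 0) ≡ (embed z == c)
    is-centre z = trans (toℕ≡0 j z) (≡true-⇔ (λ e → ==-true (⇒embed≡c z (==⇒≡ e))) (λ e → ==-true (embed≡c⇒ z (==⇒≡ e))))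

  XOn-component : ∀ m′ β → length β ≡ suc m′ → ℤ.+ XOn (suc m′) H component β ≡ st (count component) β
  XOn-component m′ β lenβ = begin
    ℤ.+ XOn (suc m′) H component β          ≡⟨ cong ℤ.+_ (InducedIsomorphism.XOn-induced {m′ = m′} H (starGraph k) component
                                                   embed index embed-in embed-index index-embed embed-adj β) ⟩
    ℤ.+ XOn (suc m′) (starGraph k) full β   ≡⟨ cong (λ z → ℤ.+ XOn z (starGraph k) full β) (sym lenβ) ⟩
    ℤ.+ XOn (length β) (starGraph k) full β ≡⟨ sym (X≡XOn-full (starGraph k) β) ⟩
    X (starGraph k) β                       ≡⟨ cong (λ z → st z β) (card≡count component) ⟩
    st (count component) β                  ∎
    where open ≡-Reasoning

All-filterᵇ : ∀ {A : Set} (q : A → Bool) xs → All (λ x → q x ≡ true) (filterᵇ q xs)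
All-filterᵇ q [] = []
All-filterᵇ q (x ∷ xs) with q x in qx
... | true = qx ∷ All-filterᵇ q xs
... | false = All-filterᵇ q xs

filterᵇ⁺ : ∀ {A : Set} {R : A → Set} (q : A → Bool) xs → All R xs → All R (filterᵇ q xs)
filterᵇ⁺ q [] [] = []
filterᵇ⁺ q (x ∷ xs) (r ∷ rs) with q x
... | true = r ∷ filterᵇ⁺ q xs rs
... | false = filterᵇ⁺ q xs rs

AllPairs-filterᵇ : ∀ {A : Set} {R : A → A → Set} (q : A → Bool) xs → AllPairs R xs → AllPairs R (filterᵇ q xs)
AllPairs-filterᵇ q [] [] = []
AllPairs-filterᵇ q (x ∷ xs) (r ∷ rs) with q x
... | true = filterᵇ⁺ q xs r ∷ AllPairs-filterᵇ q xs rs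
... | false = AllPairs-filterᵇ q xs rs

any-filterᵇ : ∀ {k} {A : Set} (h : Fin k → A) (p q : A → Bool) (z : Fin k) → q (h z) ≡ true → p (h z) ≡ true →
  any p (filterᵇ q (tabulate h)) ≡ true
any-filterᵇ h p q zero qz pz rewrite qz | pz = refl
any-filterᵇ h p q (suc z) qz pz with q (h zero)
... | true = ∨-introʳ {p (h zero)} (any-filterᵇ (λ i → h (suc i)) p q z qz pz)
... | false = any-filterᵇ (λ i → h (suc i)) p q z qz pz

any-All : ∀ {A : Set} {Q : A → Set} (p : A → Bool) xs → All Q xs → any p xs ≡ true → Σ A (λ x → Q x × p x ≡ true)
any-All p (x ∷ xs) (q ∷ qs) e with p x in px
... | true = x , q , px
... | false = any-All p xs qs e

countIn-map : ∀ {A B : Set} (p : B → Bool) (f : A → B) xs → countIn p (map f xs) ≡ countIn (λ x → p (f x)) xs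
countIn-map p f [] = refl
countIn-map p f (x ∷ xs) with p (f x)
... | true = cong suc (countIn-map p f xs)
... | false = countIn-map p f xs

countIn-filterᵇ : ∀ {A : Set} (p q : A → Bool) xs → countIn p (filterᵇ q xs) ≡ countIn (λ x → q x ∧ p x) xs
countIn-filterᵇ p q [] = refl
countIn-filterᵇ p q (x ∷ xs) with q x
... | false = countIn-filterᵇ p q xs
... | true with p x
...   | true = cong suc (countIn-filterᵇ p q xs)
...   | false = countIn-filterᵇ p q xs

∑-↭ : ∀ {A : Set} (f : A → ℕ) {xs ys : List A} → xs ↭ ys → ∑ xs f ≡ ∑ ys f
∑-↭ f ↭.refl = refl
∑-↭ f (↭.prep x r) = cong (f x +_) (∑-↭ f r)
∑-↭ f (↭.swap x y r) = trans (cong (λ z → f x + (f y + z)) (∑-↭ f r)) (exchange (f x) (f y) _)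
  where
  exchange : ∀ a b c → a + (b + c) ≡ b + (a + c)
  exchange a b c = trans (sym (+-assoc a b c)) (trans (cong (_+ c) (+-comm a b)) (+-assoc b a c))
∑-↭ f (↭.trans r s) = trans (∑-↭ f r) (∑-↭ f s)

countIn-↭ : ∀ {A : Set} (p : A → Bool) {xs ys : List A} → xs ↭ ys → countIn p xs ≡ countIn p ys
countIn-↭ p {xs} {ys} r = trans (countIn≡∑ p xs) (trans (∑-↭ (λ a → bit (p a)) r) (sym (countIn≡∑ p ys)))

sumℤ-∑ : ∀ {A : Set} (L : List A) (a b : A → ℕ) →
  ℤ.+ ∑ L (λ x → a x * b x) ≡ sumℤ (map (λ x → ℤ.+ a x *ℤ ℤ.+ b x) L)
sumℤ-∑ [] a b = refl
sumℤ-∑ (x ∷ L) a b = trans (pos-+ (a x * b x) _) (cong₂ _+ℤ_ (pos-* (a x) (b x)) (sumℤ-∑ L a b))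

sumℤ-cong : ∀ {A : Set} (L : List A) {F G : A → ℤ} → All (λ x → F x ≡ G x) L → sumℤ (map F L) ≡ sumℤ (map G L)
sumℤ-cong [] [] = refl
sumℤ-cong (x ∷ L) (e ∷ es) = cong₂ _+ℤ_ e (sumℤ-cong L es)

module Leaf {n : ℕ} (H : Graph n) (noInternal : NoInternalEdge H) where
  open WithoutInternalEdges H noInternal

  isRepresentative : Fin n → Bool
  isRepresentative x = not (any (λ y → (toℕ y <ᵇ toℕ x) ∧ conn H x y) (allFin n))

  representatives : List (Fin n)
  representatives = filterᵇ isRepresentative (allFin n)

  componentSize : Fin n → ℕ
  componentSize x = count (conn H x)

  representative-minimal : ∀ r → isRepresentative r ≡ true → ∀ y → toℕ y < toℕ r → conn H r y ≡ false
  representative-minimal r rep y y<r =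
    ¬-not (λ c → true≢false (any-allFin _ y (∧-intro (T⇒≡true (<⇒<ᵇ y<r)) c)) (not-true rep))
    where
    T⇒≡true : ∀ {b} → T b → b ≡ true
    T⇒≡true {true} _ = refl

  representative-unique : ∀ r r′ → isRepresentative r ≡ true → isRepresentative r′ ≡ true → conn H r r′ ≡ true → r ≡ r′
  representative-unique r r′ rep rep′ c with <-cmp (toℕ r) (toℕ r′)
  ... | tri< r<r′ _ _ = ⊥-elim (true≢false (conn-sym r r′ c) (representative-minimal r′ rep′ r r<r′))
  ... | tri≈ _ r≡r′ _ = toℕ-injective r≡r′
  ... | tri> _ _ r′<r = ⊥-elim (true≢false c (representative-minimal r rep r′ r′<r))

  least-is-representative : ∀ x y → conn H x y ≡ true → (∀ z → toℕ z < toℕ y → conn H x z ≡ false) →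
    isRepresentative y ≡ true
  least-is-representative x y cy minimal = not-false (any-false _ (allFin n) not-below)
    where
    not-below : ∀ z → ((toℕ z <ᵇ toℕ y) ∧ conn H y z) ≡ false
    not-below z with toℕ z <ᵇ toℕ y in e
    ... | false = refl
    ... | true = ¬-not (λ c → true≢false (conn-trans x y z cy c) (minimal z (<ᵇ⇒< (toℕ z) (toℕ y) (subst T (sym e) tt))))

  covered : List (Fin n) → Fin n → Bool
  covered rs x = any (λ r → conn H r x) rs

  covered-representatives : ∀ x → covered representatives x ≡ true
  covered-representatives x with least (conn H x) x (conn-refl x)
  ... | y , cy , minimal =
    any-filterᵇ (λ i → i) (λ r → conn H r x) isRepresentative y
      (least-is-representative x y cy minimal) (conn-sym x y cy)

  XOn-covered : ∀ m′ rs → All (λ r → isRepresentative r ≡ true) rs → AllPairs _≢_ rs → ∀ α → length α ≡ suc m′ →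
    ℤ.+ XOn (suc m′) H (covered rs) α ≡ stλ (map componentSize rs) α
  XOn-covered m′ [] _ _ α lenα =
    subst (λ k → ℤ.+ XOn k H none α ≡ oneS α) lenα (XOn-none H α (subst (0 <_) (sym lenα) (s≤s z≤n)))
  XOn-covered m′ (r ∷ rs) (rep ∷ reps) (distinct ∷ pairwise) α lenα = begin
    ℤ.+ XOn (suc m′) H (covered (r ∷ rs)) α
      ≡⟨ cong ℤ.+_ (Separated.XOn-union H (conn H r) (covered rs) α disjoint no-edge lenα) ⟩
    ℤ.+ ∑ (below α) (λ β → XOn (suc m′) H (conn H r) β * XOn (suc m′) H (covered rs) (zipWith _∸_ α β))
      ≡⟨ sumℤ-∑ (below α) (λ β → XOn (suc m′) H (conn H r) β) (λ β → XOn (suc m′) H (covered rs) (zipWith _∸_ α β)) ⟩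
    sumℤ (map (λ β → ℤ.+ XOn (suc m′) H (conn H r) β *ℤ ℤ.+ XOn (suc m′) H (covered rs) (zipWith _∸_ α β)) (below α))
      ≡⟨ sumℤ-cong (below α) (All.map factors (below-length α)) ⟩
    stλ (map componentSize (r ∷ rs)) α ∎
    where
    open ≡-Reasoning
    disjoint : ∀ x → conn H r x ≡ true → covered rs x ≡ false
    disjoint x cx = ¬-not (λ u → other-component (any-All _ rs (All.zip (reps , distinct)) u))
      where
      other-component : Σ (Fin n) (λ r′ → (isRepresentative r′ ≡ true × r ≢ r′) × conn H r′ x ≡ true) → ⊥
      other-component (r′ , (rep′ , r≢r′) , c′) =
        r≢r′ (representative-unique r r′ rep rep′ (conn-trans r x r′ cx (conn-sym r′ x c′)))
    no-edge : ∀ x y → conn H r x ≡ true → covered rs y ≡ true → adj H x y ≡ false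
    no-edge x y cx uy = ¬-not (λ a → true≢false uy (disjoint y (conn-trans r x y cx (conn-adj x y a))))
    factors : ∀ {β} → length β ≡ length α →
      ℤ.+ XOn (suc m′) H (conn H r) β *ℤ ℤ.+ XOn (suc m′) H (covered rs) (zipWith _∸_ α β)
      ≡ st (componentSize r) β *ℤ stλ (map componentSize rs) (zipWith _∸_ α β)
    factors {β} lenβ = cong₂ _*ℤ_ (StarComponent.XOn-component H noInternal r m′ β (trans lenβ lenα))
      (XOn-covered m′ rs reps pairwise (zipWith _∸_ α β) (trans (zipWith∸-length α β lenβ) lenα))

  X-leaf-∷ : ∀ a α′ → X H (a ∷ α′) ≡ stλ (lam H) (a ∷ α′)
  X-leaf-∷ a α′ = begin
    X H α                                                ≡⟨ X≡XOn-full H α ⟩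
    ℤ.+ XOn (length α) H full α                          ≡⟨ cong ℤ.+_ (countIn-cong (funs n (length α)) (λ κ →
                                                              validOn-cong-set H α κ (λ x → sym (covered-representatives x)))) ⟩
    ℤ.+ XOn (length α) H (covered representatives) α     ≡⟨ XOn-covered (length α′) representatives
                                                              (All-filterᵇ isRepresentative (allFin n))
                                                              (AllPairs-filterᵇ isRepresentative (allFin n) (allFin⁺ n)) α refl ⟩
    stλ (lam H) α                                        ∎
    where
    open ≡-Reasoning
    α : List ℕ
    α = a ∷ α′

  isolated⇔singleton : ∀ x → (isRepresentative x ∧ (componentSize x ≡ᵇ 1)) ≡ (deg H x ≡ᵇ 0)
  isolated⇔singleton x with search (adj H x)
  ... | inj₁ (y , a) = begin
    isRepresentative x ∧ (componentSize x ≡ᵇ 1) ≡⟨ cong (isRepresentative x ∧_) (≥2⇒≢1 size≥2) ⟩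
    isRepresentative x ∧ false                ≡⟨ ∧-zeroʳ (isRepresentative x) ⟩
    false                                     ≡⟨ sym (≥1⇒≢0 deg≥1) ⟩
    (deg H x ≡ᵇ 0)                            ∎
    where
    open ≡-Reasoning
    ≥2⇒≢1 : ∀ {k} → 2 ≤ k → (k ≡ᵇ 1) ≡ false
    ≥2⇒≢1 (s≤s (s≤s _)) = refl
    ≥1⇒≢0 : ∀ {k} → 1 ≤ k → (k ≡ᵇ 0) ≡ false
    ≥1⇒≢0 (s≤s _) = refl
    size≥2 : 2 ≤ componentSize x
    size≥2 = subst (2 ≤_) (sym (count≡∑Fin (conn H x)))
                   (∑Fin-bit≥2 (conn H x) x y (conn-refl x) (conn-adj x y a) (adj⇒≢ H a))
    deg≥1 : 1 ≤ deg H x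
    deg≥1 = subst (1 ≤_) (sym (count≡∑Fin (adj H x))) (∑Fin-bit≥1 (adj H x) y a)
  ... | inj₂ isolated = cong₂ _∧_ representative singleton
    where
    only-x : ∀ y → conn H x y ≡ true → x ≡ y
    only-x y c with conn⇒near x y c
    ... | inj₁ e = e
    ... | inj₂ (inj₁ a) = ⊥-elim (true≢false a (isolated y))
    ... | inj₂ (inj₂ (z , a , _)) = ⊥-elim (true≢false a (isolated z))
    representative : isRepresentative x ≡ true
    representative = least-is-representative x x (conn-refl x) (λ z z<x →
      ¬-not (λ c → <-irrefl (cong toℕ (sym (only-x z c))) z<x))
    degree-zero : deg H x ≡ 0
    degree-zero = trans (count≡∑Fin (adj H x)) (∑Fin-zero _ (λ y → cong bit (isolated y)))
    size-one : componentSize x ≡ 1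
    size-one = trans (count≡∑Fin (conn H x))
      (trans (∑Fin-cong (λ y → trans (cong bit (≡true-⇔ (λ c → ==-true (only-x y c))
                                                        (λ e → subst (λ t → conn H x t ≡ true) (==⇒≡ e) (conn-refl x))))
                                    (sym (*-identityʳ _))))
             (∑Fin-delta x (λ _ → 1)))
    singleton : (componentSize x ≡ᵇ 1) ≡ (deg H x ≡ᵇ 0)
    singleton = trans (cong (_≡ᵇ 1) size-one) (sym (cong (_≡ᵇ 0) degree-zero))

  iota≡singletons : iota H ≡ countIn (λ k → k ≡ᵇ 1) (lam H)
  iota≡singletons = sym (begin
    countIn (λ k → k ≡ᵇ 1) (map componentSize representatives)
      ≡⟨ countIn-map (λ k → k ≡ᵇ 1) componentSize representatives ⟩
    countIn (λ x → componentSize x ≡ᵇ 1) (filterᵇ isRepresentative (allFin n))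
      ≡⟨ countIn-filterᵇ (λ x → componentSize x ≡ᵇ 1) isRepresentative (allFin n) ⟩
    countIn (λ x → isRepresentative x ∧ (componentSize x ≡ᵇ 1)) (allFin n)
      ≡⟨ countIn-cong (allFin n) isolated⇔singleton ⟩
    iota H ∎)
    where open ≡-Reasoning

map-filterᵇ-head : ∀ {A B : Set} (f : A → B) (q : A → Bool) x xs → q x ≡ true →
  map f (filterᵇ q (x ∷ xs)) ≡ f x ∷ map f (filterᵇ q xs)
map-filterᵇ-head f q x xs qx rewrite qx = refl

X-leaf : ∀ {n} (H : Graph n) → NoInternalEdge H → ∀ α → X H α ≡ stλ (lam H) α
X-leaf H noInternal (a ∷ α) = Leaf.X-leaf-∷ H noInternal a α
X-leaf {zero} H noInternal [] = refl
-- With no colours available both sides vanish, the right-hand side through its first part.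
X-leaf {suc n} H noInternal [] =
  sym (trans (cong (λ l → stλ l []) lam≡) (no-colouring (componentSize zero) {map componentSize (filterᵇ isRepresentative (tabulate suc))} size≥1))
  where
  open WithoutInternalEdges H noInternal
  open Leaf H noInternal
  zero-representative : isRepresentative zero ≡ true
  zero-representative = not-false (any-false _ (allFin (suc n)) (λ y → refl))
  lam≡ : lam H ≡ componentSize zero ∷ map componentSize (filterᵇ isRepresentative (tabulate suc))
  lam≡ = map-filterᵇ-head componentSize isRepresentative zero (tabulate suc) zero-representative
  size≥1 : 1 ≤ componentSize zero
  size≥1 = subst (1 ≤_) (sym (count≡∑Fin (conn H zero))) (∑Fin-bit≥1 (conn H zero) zero (conn-refl zero))
  no-colouring : ∀ k {ks} → 1 ≤ k → stλ (k ∷ ks) [] ≡ ℤ.+ 0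
  no-colouring (suc k) _ = refl

-- Deletion and contraction

isPair⇒ : ∀ {n} {u v x y : Fin n} → isPair u v x y ≡ true → (x ≡ u × y ≡ v) ⊎ (x ≡ v × y ≡ u)
isPair⇒ {u = u} {v} {x} {y} e with ∨-elim {(x == u) ∧ (y == v)} e
... | inj₁ p = inj₁ (==⇒≡ (∧-elimˡ p) , ==⇒≡ (∧-elimʳ {x == u} p))
... | inj₂ p = inj₂ (==⇒≡ (∧-elimˡ p) , ==⇒≡ (∧-elimʳ {x == v} p))

isPair-false : ∀ {n} {u v x y : Fin n} → ¬ (x ≡ u × y ≡ v) → ¬ (x ≡ v × y ≡ u) → isPair u v x y ≡ false
isPair-false not-uv not-vu = ¬-not (λ e → [ not-uv , not-vu ]′ (isPair⇒ e))

isPair-uv : ∀ {n} (u v : Fin n) → isPair u v u v ≡ true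
isPair-uv u v = ∨-introˡ (∧-intro (==-refl u) (==-refl v))

isPair-vu : ∀ {n} (u v : Fin n) → isPair u v v u ≡ true
isPair-vu u v = ∨-introʳ {(v == u) ∧ (u == v)} (∧-intro (==-refl v) (==-refl u))

isPair-sym : ∀ {n} {u v x y : Fin n} → isPair u v x y ≡ false → isPair u v y x ≡ false
isPair-sym {u = u} {v} {x} {y} np =
  isPair-false {u = u} {v} {y} {x} (λ { (refl , refl) → true≢false (isPair-vu u v) np })
                                    (λ { (refl , refl) → true≢false (isPair-uv u v) np })

proper⇒ : ∀ {n m} (K : Graph n) (κ : Colouring n m) → proper K κ ≡ true →
  ∀ x y → adj K x y ≡ true → (κ x == κ y) ≡ false
proper⇒ {n} K κ e x y a = nand⇒ (adj K x y) (κ x == κ y) (∀ᵇ-elim (row x) (trans (sym (all-allFin (row x))) outer) y) a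
  where
  row : Fin n → Fin n → Bool
  row x y = not (adj K x y) ∨ not (κ x == κ y)
  outer : all (row x) (allFin n) ≡ true
  outer = ∀ᵇ-elim (λ x → all (row x) (allFin n)) (trans (sym (all-allFin (λ x → all (row x) (allFin n)))) e) x

⇒proper : ∀ {n m} (K : Graph n) (κ : Colouring n m) → (∀ x y → adj K x y ≡ true → (κ x == κ y) ≡ false) →
  proper K κ ≡ true
⇒proper {n} K κ h = trans (all-allFin (λ x → all (row x) (allFin n))) (∀ᵇ-intro _ (λ x →
  trans (all-allFin (row x)) (∀ᵇ-intro (row x) (λ y → ⇒nand (adj K x y) (κ x == κ y) (h x y)))))
  where
  row : Fin n → Fin n → Bool
  row x y = not (adj K x y) ∨ not (κ x == κ y)

countIn-split : {A : Set} (xs : List A) (f r g : A → Bool) →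
  countIn (λ a → f a ∧ g a) xs ≡ countIn (λ a → (f a ∧ not (r a)) ∧ g a) xs + countIn (λ a → (f a ∧ r a) ∧ g a) xs
countIn-split xs f r g =
  trans (countIn≡∑ _ xs) (trans (∑-cong xs split) (trans (∑-+ xs _ _) (sym (cong₂ _+_ (countIn≡∑ _ xs) (countIn≡∑ _ xs)))))
  where
  split : ∀ a → bit (f a ∧ g a) ≡ bit ((f a ∧ not (r a)) ∧ g a) + bit ((f a ∧ r a) ∧ g a)
  split a with f a | r a | g a
  ... | true | true | true = refl
  ... | true | true | false = refl
  ... | true | false | true = refl
  ... | true | false | false = refl
  ... | false | _ | _ = refl

∧-congʳ-if : ∀ {p q r : Bool} → (r ≡ true → p ≡ q) → (p ∧ r) ≡ (q ∧ r)
∧-congʳ-if {p} {q} {true} h = trans (∧-identityʳ p) (trans (h refl) (sym (∧-identityʳ q)))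
∧-congʳ-if {p} {q} {false} h = trans (∧-zeroʳ p) (sym (∧-zeroʳ q))

cancel-shared : ∀ (a b c : ℤ) → a ≡ (a +ℤ b) +ℤ (c -ℤ (c +ℤ b))
cancel-shared = solve-∀

module Contraction {n : ℕ} (H : Graph n) (u v : Fin n) (uv : adj H u v ≡ true) where

  u≢v : u ≢ v
  u≢v = adj⇒≢ H uv

  ⊙ : Bool → Graph n
  ⊙ withℓ = odotGen withℓ H u v

  identify : Fin n → Fin n
  identify z = if z == v then u else z

  identify-v : identify v ≡ u
  identify-v = if-true u v (==-refl v)

  identify-other : ∀ z → z ≢ v → identify z ≡ z
  identify-other z z≢v = if-false u z (==-false z≢v)

  identify≢v : ∀ z → identify z ≢ v
  identify≢v z with toSum (z ≟ v)
  ... | inj₁ refl = λ e → u≢v (trans (sym identify-v) e)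
  ... | inj₂ z≢v = λ e → z≢v (trans (sym (identify-other z z≢v)) e)

  touches-v : Fin n → Fin n → Bool
  touches-v x y = (x == v) ∨ (y == v)

  avoids-v : ∀ {x y} → x ≢ v → y ≢ v → touches-v x y ≡ false
  avoids-v x≢v y≢v = cong₂ _∨_ (==-false x≢v) (==-false y≢v)

  ⊙-at-v : ∀ b x y → touches-v x y ≡ true → ⊙ b x y ≡ (b ∧ isPair u v x y)
  ⊙-at-v b x y t = if-true (b ∧ isPair u v x y) _ t

  ⊙-from-u : ∀ b y → touches-v u y ≡ false → ⊙ b u y ≡ (adj H u y ∨ adj H v y)
  ⊙-from-u b y t = trans (if-false (b ∧ isPair u v u y) _ t) (if-true (adj H u y ∨ adj H v y) _ (==-refl u))

  ⊙-to-u : ∀ b x → touches-v x u ≡ false → x ≢ u → ⊙ b x u ≡ (adj H x u ∨ adj H x v)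
  ⊙-to-u b x t x≢u = trans (if-false (b ∧ isPair u v x u) _ t)
    (trans (if-false (adj H u u ∨ adj H v u) _ (==-false x≢u)) (if-true (adj H x u ∨ adj H x v) (adj H x u) (==-refl u)))

  ⊙-away : ∀ b x y → touches-v x y ≡ false → x ≢ u → y ≢ u → ⊙ b x y ≡ adj H x y
  ⊙-away b x y t x≢u y≢u = trans (if-false (b ∧ isPair u v x y) _ t)
    (trans (if-false (adj H u y ∨ adj H v y) _ (==-false x≢u)) (if-false (adj H x u ∨ adj H x v) (adj H x y) (==-false y≢u)))

  adj-⊙-u : ∀ b y → y ≢ u → y ≢ v → (adj H u y ∨ adj H v y) ≡ true → adj (⊙ b) u y ≡ true
  adj-⊙-u b y y≢u y≢v h = adj-intro (⊙ b) u y (λ e → y≢u (sym e)) (trans (⊙-from-u b y (avoids-v u≢v y≢v)) h)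

  adj-⊙-away : ∀ b x y → x ≢ u → x ≢ v → y ≢ u → y ≢ v → adj H x y ≡ true → adj (⊙ b) x y ≡ true
  adj-⊙-away b x y x≢u x≢v y≢u y≢v a =
    adj-intro (⊙ b) x y (adj⇒≢ H a) (trans (⊙-away b x y (avoids-v x≢v y≢v) x≢u y≢u) a)

  adj-⊙-image : ∀ b x y → adj H x y ≡ true → isPair u v x y ≡ false → adj (⊙ b) (identify x) (identify y) ≡ true
  adj-⊙-image b x y a np with toSum (x ≟ v) | toSum (x ≟ u) | toSum (y ≟ v) | toSum (y ≟ u)
  ... | inj₁ refl | _ | inj₁ refl | _ = ⊥-elim (adj⇒≢ H a refl)
  ... | inj₁ refl | _ | _ | inj₁ refl = ⊥-elim (true≢false (isPair-vu u v) np)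
  ... | inj₁ refl | _ | inj₂ y≢v | inj₂ y≢u
    rewrite identify-v | identify-other y y≢v = adj-⊙-u b y y≢u y≢v (∨-introʳ {adj H u y} a)
  ... | inj₂ x≢v | inj₁ refl | inj₁ refl | _ = ⊥-elim (true≢false (isPair-uv u v) np)
  ... | inj₂ x≢v | inj₁ refl | _ | inj₁ refl = ⊥-elim (adj⇒≢ H a refl)
  ... | inj₂ x≢v | inj₁ refl | inj₂ y≢v | inj₂ y≢u
    rewrite identify-other x x≢v | identify-other y y≢v = adj-⊙-u b y y≢u y≢v (∨-introˡ a)
  ... | inj₂ x≢v | inj₂ x≢u | inj₁ refl | _
    rewrite identify-other x x≢v | identify-v = adj-symm (⊙ b) {u} {x} (adj-⊙-u b x x≢u x≢v (∨-introʳ {adj H u x} (adj-symm H a)))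
  ... | inj₂ x≢v | inj₂ x≢u | inj₂ y≢v | inj₁ refl
    rewrite identify-other x x≢v | identify-other y y≢v = adj-symm (⊙ b) {u} {x} (adj-⊙-u b x x≢u x≢v (∨-introˡ (adj-symm H a)))
  ... | inj₂ x≢v | inj₂ x≢u | inj₂ y≢v | inj₂ y≢u
    rewrite identify-other x x≢v | identify-other y y≢v = adj-⊙-away b x y x≢u x≢v y≢u y≢v a

  ⊙-Edge : Bool → Fin n → Fin n → Set
  ⊙-Edge b x y = ((b ≡ true) × (isPair u v x y ≡ true)) ⊎
    Σ (Fin n) (λ x′ → Σ (Fin n) (λ y′ →
      (adj H x′ y′ ≡ true) × (isPair u v x′ y′ ≡ false) × (identify x′ ≡ x) × (identify y′ ≡ y)))

  ⊙-Edge-sym : ∀ b x y → ⊙-Edge b x y → ⊙-Edge b y x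
  ⊙-Edge-sym b x y (inj₁ (bt , p)) with isPair⇒ {u = u} {v} {x} {y} p
  ... | inj₁ (refl , refl) = inj₁ (bt , isPair-vu u v)
  ... | inj₂ (refl , refl) = inj₁ (bt , isPair-uv u v)
  ⊙-Edge-sym b x y (inj₂ (x′ , y′ , a , np , ix , iy)) = inj₂ (y′ , x′ , adj-symm H a , isPair-sym {u = u} {v} {x′} {y′} np , iy , ix)

  lift : ∀ b x y → adj H x y ≡ true → isPair u v x y ≡ false → x ≢ v → y ≢ v → ⊙-Edge b x y
  lift b x y a np x≢v y≢v = inj₂ (x , y , a , np , identify-other x x≢v , identify-other y y≢v)

  ⊙-origin : ∀ b x y → x ≢ y → ⊙ b x y ≡ true → ⊙-Edge b x y
  ⊙-origin b x y x≢y o with toSum (x ≟ v) | toSum (y ≟ v)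
  ... | inj₁ refl | _ = inj₁ (∧-elimˡ o′ , ∧-elimʳ {b} o′)
    where o′ = trans (sym (⊙-at-v b x y (∨-introˡ (==-refl x)))) o
  ... | inj₂ _ | inj₁ refl = inj₁ (∧-elimˡ o′ , ∧-elimʳ {b} o′)
    where o′ = trans (sym (⊙-at-v b x y (∨-introʳ {x == y} (==-refl y)))) o
  ... | inj₂ x≢v | inj₂ y≢v with toSum (x ≟ u) | toSum (y ≟ u)
  ...   | inj₁ refl | _ with ∨-elim {adj H x y} (trans (sym (⊙-from-u b y (avoids-v x≢v y≢v))) o)
  ...     | inj₁ a = lift b x y a (isPair-false (λ p → y≢v (proj₂ p)) (λ p → x≢v (proj₁ p))) x≢v y≢v
  ...     | inj₂ a = inj₂ (v , y , a , isPair-false (λ p → u≢v (sym (proj₁ p))) (λ p → x≢y (sym (proj₂ p))) ,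
                           identify-v , identify-other y y≢v)
  ⊙-origin b x y x≢y o | inj₂ x≢v | inj₂ y≢v | inj₂ x≢u | inj₁ refl
    with ∨-elim {adj H x y} (trans (sym (⊙-to-u b x (avoids-v x≢v y≢v) x≢u)) o)
  ...     | inj₁ a = lift b x y a (isPair-false (λ p → x≢u (proj₁ p)) (λ p → x≢v (proj₁ p))) x≢v y≢v
  ...     | inj₂ a = inj₂ (x , v , a , isPair-false (λ p → x≢u (proj₁ p)) (λ p → x≢v (proj₁ p)) ,
                           identify-other x x≢v , identify-v)
  ⊙-origin b x y x≢y o | inj₂ x≢v | inj₂ y≢v | inj₂ x≢u | inj₂ y≢u =
    lift b x y (trans (sym (⊙-away b x y (avoids-v x≢v y≢v) x≢u y≢u)) o)
         (isPair-false (λ p → x≢u (proj₁ p)) (λ p → x≢v (proj₁ p))) x≢v y≢v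

  adj-⊙-origin : ∀ b x y → adj (⊙ b) x y ≡ true → ⊙-Edge b x y
  adj-⊙-origin b x y a with ∨-elim {⊙ b x y} (∧-elimʳ {not (x == y)} a)
  ... | inj₁ o = ⊙-origin b x y (adj⇒≢ (⊙ b) a) o
  ... | inj₂ o = ⊙-Edge-sym b y x (⊙-origin b y x (λ e → adj⇒≢ (⊙ b) a (sym e)) o)

  ⊙-mono : ∀ x y → ⊙ false x y ≡ true → ⊙ true x y ≡ true
  ⊙-mono x y e with touches-v x y
  ... | false = e

  adj-⊙-mono : ∀ x y → adj (⊙ false) x y ≡ true → adj (⊙ true) x y ≡ true
  adj-⊙-mono x y a with ∨-elim {⊙ false x y} (∧-elimʳ {not (x == y)} a)
  ... | inj₁ o = ∧-intro (∧-elimˡ a) (∨-introˡ (⊙-mono x y o))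
  ... | inj₂ o = ∧-intro (∧-elimˡ a) (∨-introʳ {⊙ true x y} (⊙-mono y x o))

  ℓ-edge : adj (⊙ true) u v ≡ true
  ℓ-edge = adj-intro (⊙ true) u v u≢v (trans (⊙-at-v true u v (∨-introʳ {u == v} (==-refl v))) (isPair-uv u v))

  H∖e : Graph n
  H∖e = delEdge H u v

  adj-∖⇒ : ∀ x y → adj H∖e x y ≡ true → (adj H x y ≡ true) × (isPair u v x y ≡ false)
  adj-∖⇒ x y a with ∨-elim {H∖e x y} (∧-elimʳ {not (x == y)} a)
  ... | inj₁ d = ∧-elimˡ d , not-true (∧-elimʳ {adj H x y} d)
  ... | inj₂ d = adj-symm H (∧-elimˡ d) , isPair-sym {u = u} {v} {y} {x} (not-true (∧-elimʳ {adj H y x} d))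

  ⇒adj-∖ : ∀ x y → adj H x y ≡ true → isPair u v x y ≡ false → adj H∖e x y ≡ true
  ⇒adj-∖ x y a np = ∧-intro (∧-elimˡ a) (∨-introˡ {H∖e x y} {H∖e y x} (∧-intro a (not-false np)))

  module _ {m : ℕ} (κ : Colouring n m) where

    pair-distinct : ∀ x y → isPair u v x y ≡ true → not (κ u == κ v) ≡ true → (κ x == κ y) ≡ false
    pair-distinct x y p κu≢κv with isPair⇒ {u = u} {v} {x} {y} p
    ... | inj₁ (refl , refl) = not-true κu≢κv
    ... | inj₂ (refl , refl) = trans (==-sym (κ v) (κ u)) (not-true κu≢κv)

    proper-H : proper H κ ≡ (proper H∖e κ ∧ not (κ u == κ v))
    proper-H = ≡true-⇔ to from
      where
      to : proper H κ ≡ true → (proper H∖e κ ∧ not (κ u == κ v)) ≡ true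
      to p = ∧-intro (⇒proper H∖e κ (λ x y a → proper⇒ H κ p x y (proj₁ (adj-∖⇒ x y a))))
                     (not-false (proper⇒ H κ p u v uv))
      from : (proper H∖e κ ∧ not (κ u == κ v)) ≡ true → proper H κ ≡ true
      from p = ⇒proper H κ (λ x y a → by-pair x y a (isPair u v x y) refl)
        where
        by-pair : ∀ x y → adj H x y ≡ true → ∀ b → isPair u v x y ≡ b → (κ x == κ y) ≡ false
        by-pair x y a true ip = pair-distinct x y ip (∧-elimʳ {proper H∖e κ} p)
        by-pair x y a false np = proper⇒ H∖e κ (∧-elimˡ p) x y (⇒adj-∖ x y a np)

    proper-∖≡proper-⊙⁻ : κ u ≡ κ v → proper H∖e κ ≡ proper (⊙ false) κ
    proper-∖≡proper-⊙⁻ κu≡κv = ≡true-⇔ to from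
      where
      κ∘identify : ∀ z → κ (identify z) ≡ κ z
      κ∘identify z with toSum (z ≟ v)
      ... | inj₁ refl = trans (cong κ identify-v) κu≡κv
      ... | inj₂ z≢v = cong κ (identify-other z z≢v)
      to : proper H∖e κ ≡ true → proper (⊙ false) κ ≡ true
      to p = ⇒proper (⊙ false) κ distinct
        where
        distinct : ∀ x y → adj (⊙ false) x y ≡ true → (κ x == κ y) ≡ false
        distinct x y a with adj-⊙-origin false x y a
        ... | inj₁ (() , _)
        ... | inj₂ (x′ , y′ , a′ , np , refl , refl) =
          trans (cong₂ _==_ (κ∘identify x′) (κ∘identify y′)) (proper⇒ H∖e κ p x′ y′ (⇒adj-∖ x′ y′ a′ np))
      from : proper (⊙ false) κ ≡ true → proper H∖e κ ≡ true
      from p = ⇒proper H∖e κ (λ x y a →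
        trans (sym (cong₂ _==_ (κ∘identify x) (κ∘identify y)))
              (proper⇒ (⊙ false) κ p (identify x) (identify y)
                       (adj-⊙-image false x y (proj₁ (adj-∖⇒ x y a)) (proj₂ (adj-∖⇒ x y a)))))

    proper-⊙ : proper (⊙ true) κ ≡ (proper (⊙ false) κ ∧ not (κ u == κ v))
    proper-⊙ = ≡true-⇔ to from
      where
      to : proper (⊙ true) κ ≡ true → (proper (⊙ false) κ ∧ not (κ u == κ v)) ≡ true
      to p = ∧-intro (⇒proper (⊙ false) κ (λ x y a → proper⇒ (⊙ true) κ p x y (adj-⊙-mono x y a)))
                     (not-false (proper⇒ (⊙ true) κ p u v ℓ-edge))
      from : (proper (⊙ false) κ ∧ not (κ u == κ v)) ≡ true → proper (⊙ true) κ ≡ true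
      from p = ⇒proper (⊙ true) κ distinct
        where
        distinct : ∀ x y → adj (⊙ true) x y ≡ true → (κ x == κ y) ≡ false
        distinct x y a with adj-⊙-origin true x y a
        ... | inj₁ (_ , ip) = pair-distinct x y ip (∧-elimʳ {proper (⊙ false) κ} p)
        ... | inj₂ (x′ , y′ , a′ , np , refl , refl) =
          proper⇒ (⊙ false) κ (∧-elimˡ p) (identify x′) (identify y′) (adj-⊙-image false x′ y′ a′ np)

  deletion-contraction : ∀ α → X H α ≡ X H∖e α +ℤ (X (⊙ true) α -ℤ X (⊙ false) α)
  deletion-contraction α = begin
    X H α                                                       ≡⟨ cong ℤ.+_ (countIn-cong fs (λ κ → cong (_∧ hc κ) (proper-H κ))) ⟩
    ℤ.+ A                                                       ≡⟨ cancel-shared (ℤ.+ A) (ℤ.+ B) (ℤ.+ C) ⟩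
    (ℤ.+ A +ℤ ℤ.+ B) +ℤ (ℤ.+ C -ℤ (ℤ.+ C +ℤ ℤ.+ B))          ≡⟨ sym (cong₂ _+ℤ_ (pos-+ A B) (cong (λ z → ℤ.+ C -ℤ z) (pos-+ C B))) ⟩
    ℤ.+ (A + B) +ℤ (ℤ.+ C -ℤ ℤ.+ (C + B))                       ≡⟨ sym (cong₂ _+ℤ_ X∖e (cong₂ _-ℤ_ X⊙ X⊙⁻)) ⟩
    X H∖e α +ℤ (X (⊙ true) α -ℤ X (⊙ false) α)                 ∎
    where
    open ≡-Reasoning
    m : ℕ
    m = length α
    fs : List (Colouring n m)
    fs = funs n m
    hc : Colouring n m → Bool
    hc κ = hasContent α κ
    equal : Colouring n m → Bool
    equal κ = κ u == κ v
    A B C : ℕ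
    A = countIn (λ κ → (proper H∖e κ ∧ not (equal κ)) ∧ hc κ) fs
    B = countIn (λ κ → (proper (⊙ false) κ ∧ equal κ) ∧ hc κ) fs
    C = countIn (λ κ → (proper (⊙ false) κ ∧ not (equal κ)) ∧ hc κ) fs
    X∖e : X H∖e α ≡ ℤ.+ (A + B)
    X∖e = cong ℤ.+_ (trans (countIn-split fs (proper H∖e) equal hc)
      (cong (A +_) (countIn-cong fs (λ κ → cong (_∧ hc κ) (∧-congʳ-if (λ e → proper-∖≡proper-⊙⁻ κ (==⇒≡ e)))))))
    X⊙ : X (⊙ true) α ≡ ℤ.+ C
    X⊙ = cong ℤ.+_ (countIn-cong fs (λ κ → cong (_∧ hc κ) (proper-⊙ κ)))
    X⊙⁻ : X (⊙ false) α ≡ ℤ.+ (C + B)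
    X⊙⁻ = cong ℤ.+_ (countIn-split fs (proper (⊙ false)) equal hc)

HasNeighbour : ∀ {n} → Graph n → Fin n → Set
HasNeighbour K x = Σ (Fin _) (λ y → adj K x y ≡ true)

isolated : ∀ {n} → Graph n → Fin n → Bool
isolated K x = deg K x ≡ᵇ 0

isolated-false : ∀ {n} (K : Graph n) x → HasNeighbour K x → isolated K x ≡ false
isolated-false K x (y , a) with deg K x | count≡∑Fin (adj K x) | ∑Fin-bit≥1 (adj K x) y a
... | suc d | _ | _ = refl
... | zero | e | r = ⊥-elim (1+n≰n (subst (1 ≤_) (sym e) r))

isolated-true : ∀ {n} (K : Graph n) x → (∀ y → adj K x y ≡ false) → isolated K x ≡ true
isolated-true K x h = cong (_≡ᵇ 0) (trans (count≡∑Fin (adj K x)) (∑Fin-zero _ (λ y → cong bit (h y))))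

isolated-cong : ∀ {n} (K K′ : Graph n) x → (HasNeighbour K x → HasNeighbour K′ x) → (HasNeighbour K′ x → HasNeighbour K x) →
  isolated K x ≡ isolated K′ x
isolated-cong K K′ x to from with search (adj K x) | search (adj K′ x)
... | inj₁ h | _ = trans (isolated-false K x h) (sym (isolated-false K′ x (to h)))
... | inj₂ h | inj₁ h′ = ⊥-elim (true≢false (proj₂ (from h′)) (h (proj₁ (from h′))))
... | inj₂ h | inj₂ h′ = trans (isolated-true K x h) (sym (isolated-true K′ x h′))

neighbour-besides : ∀ {n} (H : Graph n) u v → 1 < deg H u → Σ (Fin n) (λ w → (adj H u w ≡ true) × (w ≢ v))
neighbour-besides {n} H u v du with search (λ w → adj H u w ∧ not (w == v))
... | inj₁ (w , e) = w , ∧-elimˡ e , (λ w≡v → true≢false (==-true w≡v) (not-true (∧-elimʳ {adj H u w} e)))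
... | inj₂ h = ⊥-elim (<-irrefl refl (≤-trans du (subst (_≤ 1) (sym (count≡∑Fin (adj H u))) (∑Fin-bit≤1 (adj H u) v only-v))))
  where
  only-v : ∀ w → w ≢ v → adj H u w ≡ false
  only-v w w≢v = ¬-not (λ a → true≢false (∧-intro a (not-false (==-false w≢v))) (h w))

module ExpansionStep {n : ℕ} (H : Graph n) (u v : Fin n) (uv : adj H u v ≡ true) (du : 1 < deg H u) (dv : 1 < deg H v) where
  open Contraction H u v uv

  iota-∖ : iota H∖e ≡ iota H
  iota-∖ = countIn-cong (allFin n) (λ x → isolated-cong H∖e H x (λ { (y , a) → y , proj₁ (adj-∖⇒ x y a) }) (from x))
    where
    from : ∀ x → HasNeighbour H x → HasNeighbour H∖e x
    from x (y , a) with isPair u v x y in ip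
    ... | false = y , ⇒adj-∖ x y a ip
    ... | true with isPair⇒ {u = u} {v} {x} {y} ip
    ...   | inj₁ (refl , refl) with neighbour-besides H u v du
    ...     | w , aw , w≢v = w , ⇒adj-∖ u w aw (isPair-false (λ p → w≢v (proj₂ p)) (λ p → u≢v (proj₁ p)))
    from x (y , a) | true | inj₂ (refl , refl) with neighbour-besides H v u dv
    ...     | w , aw , w≢u = w , ⇒adj-∖ v w aw (isPair-false (λ p → u≢v (sym (proj₁ p))) (λ p → w≢u (proj₂ p)))

  neighbour-⊙⇒ : ∀ b x → x ≢ v → HasNeighbour (⊙ b) x → HasNeighbour H x
  neighbour-⊙⇒ b x x≢v (y , d) with toSum (x ≟ u)
  ... | inj₁ refl = v , uv
  ... | inj₂ x≢u with adj-⊙-origin b x y d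
  ...   | inj₁ (_ , ip) = ⊥-elim ([ (λ p → x≢u (proj₁ p)) , (λ p → x≢v (proj₁ p)) ]′ (isPair⇒ {u = u} {v} {x} {y} ip))
  ...   | inj₂ (x′ , y′ , a′ , _ , ix , _) with toSum (x′ ≟ v)
  ...     | inj₁ refl = ⊥-elim (x≢u (trans (sym ix) identify-v))
  ...     | inj₂ x′≢v = y′ , subst (λ t → adj H t y′ ≡ true) (trans (sym (identify-other x′ x′≢v)) ix) a′

  neighbour-⊙⇐ : ∀ b x → x ≢ v → HasNeighbour H x → HasNeighbour (⊙ b) x
  neighbour-⊙⇐ b x x≢v (y , a) with toSum (x ≟ u)
  ... | inj₁ refl with neighbour-besides H u v du
  ...   | w , aw , w≢v = identify w , subst (λ t → adj (⊙ b) t (identify w) ≡ true) (identify-other x x≢v)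
                           (adj-⊙-image b x w aw (isPair-false (λ p → w≢v (proj₂ p)) (λ p → x≢v (proj₁ p))))
  neighbour-⊙⇐ b x x≢v (y , a) | inj₂ x≢u = identify y , subst (λ t → adj (⊙ b) t (identify y) ≡ true) (identify-other x x≢v)
                           (adj-⊙-image b x y a (isPair-false (λ p → x≢u (proj₁ p)) (λ p → x≢v (proj₁ p))))

  isolated-⊙-away : ∀ b x → x ≢ v → isolated (⊙ b) x ≡ isolated H x
  isolated-⊙-away b x x≢v = isolated-cong (⊙ b) H x (neighbour-⊙⇒ b x x≢v) (neighbour-⊙⇐ b x x≢v)

  iota-⊙ : iota (⊙ true) ≡ iota H
  iota-⊙ = trans (count≡∑Fin (isolated (⊙ true))) (trans (∑Fin-cong same) (sym (count≡∑Fin (isolated H))))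
    where
    same : ∀ x → bit (isolated (⊙ true) x) ≡ bit (isolated H x)
    same x with toSum (x ≟ v)
    ... | inj₁ refl = cong bit (trans (isolated-false (⊙ true) x (u , adj-symm (⊙ true) {u} {v} ℓ-edge))
                                      (sym (isolated-false H x (u , adj-symm H uv))))
    ... | inj₂ x≢v = cong bit (isolated-⊙-away true x x≢v)

  iota-⊙⁻ : iota (⊙ false) ≡ suc (iota H)
  iota-⊙⁻ = trans (count≡∑Fin (isolated (⊙ false)))
    (trans (∑Fin-bit-insert (isolated H) (isolated (⊙ false)) v (isolated-⊙-away false)
                            (isolated-false H v (u , adj-symm H uv)) (isolated-true (⊙ false) v v-isolated))
           (cong suc (sym (count≡∑Fin (isolated H)))))
    where
    v-isolated : ∀ y → adj (⊙ false) v y ≡ false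
    v-isolated y = ¬-not (λ d → no-origin (adj-⊙-origin false v y d))
      where
      no-origin : ⊙-Edge false v y → ⊥
      no-origin (inj₁ (() , _))
      no-origin (inj₂ (x′ , _ , _ , _ , ix , _)) = identify≢v x′ ix

even : ℕ → Bool
even zero = true
even (suc zero) = false
even (suc (suc k)) = even k

even-suc : ∀ k → even (suc k) ≡ not (even k)
even-suc zero = refl
even-suc (suc zero) = refl
even-suc (suc (suc k)) = even-suc k

sign : Bool → ℤ
sign true = ℤ.+ 1
sign false = ℤ.- (ℤ.+ 1)

sign-not : ∀ b → sign (not b) ≡ ℤ.- sign b
sign-not true = refl
sign-not false = refl

negOnePow≡sign : ∀ z → negOnePow z ≡ sign (even ∣ z ∣)
negOnePow≡sign z = by-parity (mod2≡even ∣ z ∣)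
  where
  mod2≡even : ∀ k → ((k % 2) ≡ᵇ 0) ≡ even k
  mod2≡even zero = refl
  mod2≡even (suc zero) = refl
  mod2≡even (suc (suc k)) = trans (cong (λ z → (z % 2) ≡ᵇ 0) (+-comm 2 k))
                                  (trans (cong (_≡ᵇ 0) ([m+n]%n≡m%n k 2)) (mod2≡even k))
  by-parity : ∀ {b c} → b ≡ c → (if b then ℤ.+ 1 else ℤ.- (ℤ.+ 1)) ≡ sign c
  by-parity {true} refl = refl
  by-parity {false} refl = refl

∣⊖suc∣ : ∀ a b → (∣ a ⊖ suc b ∣ ≡ suc ∣ a ⊖ b ∣) ⊎ (suc ∣ a ⊖ suc b ∣ ≡ ∣ a ⊖ b ∣)
∣⊖suc∣ zero zero = inj₁ refl
∣⊖suc∣ zero (suc b) = inj₁ refl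
∣⊖suc∣ (suc a) zero = inj₂ (cong (λ z → suc ∣ z ∣) ([1+m]⊖[1+n]≡m⊖n a 0))
∣⊖suc∣ (suc a) (suc b) rewrite [1+m]⊖[1+n]≡m⊖n a (suc b) | [1+m]⊖[1+n]≡m⊖n a b = ∣⊖suc∣ a b

negOnePow-suc : ∀ a b → negOnePow (ℤ.+ a -ℤ ℤ.+ suc b) ≡ ℤ.- negOnePow (ℤ.+ a -ℤ ℤ.+ b)
negOnePow-suc a b rewrite [+m]-[+n]≡m⊖n a (suc b) | [+m]-[+n]≡m⊖n a b
                        | negOnePow≡sign (a ⊖ suc b) | negOnePow≡sign (a ⊖ b) with ∣⊖suc∣ a b
... | inj₁ e rewrite e = trans (cong sign (even-suc ∣ a ⊖ b ∣)) (sign-not (even ∣ a ⊖ b ∣))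
... | inj₂ e rewrite sym e =
  trans (sym (neg-involutive _)) (cong ℤ.-_ (sym (trans (cong sign (even-suc ∣ a ⊖ suc b ∣)) (sign-not (even ∣ a ⊖ suc b ∣)))))

sgn-self : ∀ {n} (H : Graph n) → sgn H H ≡ ℤ.+ 1
sgn-self H rewrite [+m]-[+n]≡m⊖n (iota H) (iota H) | n⊖n≡0 (iota H) = refl

sgn-cong : ∀ {n} {H K : Graph n} (L : Graph n) → iota K ≡ iota H → sgn K L ≡ sgn H L
sgn-cong {H = H} L e = cong (λ i → negOnePow (ℤ.+ iota L -ℤ ℤ.+ i)) e

sgn-suc : ∀ {n} {H K : Graph n} (L : Graph n) → iota K ≡ suc (iota H) → sgn K L ≡ ℤ.- sgn H L
sgn-suc {H = H} L e = trans (cong (λ i → negOnePow (ℤ.+ iota L -ℤ ℤ.+ i)) e) (negOnePow-suc (iota L) (iota H))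

sumℤ-map-cong : ∀ {A : Set} (xs : List A) {F G : A → ℤ} → (∀ x → F x ≡ G x) → sumℤ (map F xs) ≡ sumℤ (map G xs)
sumℤ-map-cong [] e = refl
sumℤ-map-cong (x ∷ xs) e = cong₂ _+ℤ_ (e x) (sumℤ-map-cong xs e)

sumℤ-++ : ∀ {A : Set} (F : A → ℤ) (xs ys : List A) → sumℤ (map F (xs ++ ys)) ≡ sumℤ (map F xs) +ℤ sumℤ (map F ys)
sumℤ-++ F [] ys = sym (+-identityˡ-ℤ _)
sumℤ-++ F (x ∷ xs) ys = trans (cong (F x +ℤ_) (sumℤ-++ F xs ys)) (sym (+-assoc-ℤ (F x) _ _))

sumℤ-neg : ∀ {A : Set} (xs : List A) (F : A → ℤ) → sumℤ (map (λ x → ℤ.- F x) xs) ≡ ℤ.- sumℤ (map F xs)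
sumℤ-neg [] F = refl
sumℤ-neg (x ∷ xs) F = trans (cong (ℤ.- F x +ℤ_) (sumℤ-neg xs F)) (sym (neg-distrib-+ (F x) _))

signedSum : ∀ {n} → Graph n → List (Graph n) → List ℕ → ℤ
signedSum H Ls α = sumℤ (map (λ L → sgn H L *ℤ stλ (lam L) α) Ls)

leaves-noInternal : ∀ {n} {G : Graph n} (T : ExpTree G) → All NoInternalEdge (leaves T)
leaves-noInternal (leaf noInternal) = noInternal ∷ []
leaves-noInternal (node u v _ t₁ t₂ t₃) =
  ++⁺ (leaves-noInternal t₁) (++⁺ (leaves-noInternal t₂) (leaves-noInternal t₃))

X-expansion : ∀ {n} (H : Graph n) (T : ExpTree H) α → X H α ≡ signedSum H (leaves T) α
X-expansion H (leaf noInternal) α = begin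
  X H α                                     ≡⟨ X-leaf H noInternal α ⟩
  stλ (lam H) α                             ≡⟨ sym (*-identityˡ-ℤ _) ⟩
  ℤ.+ 1 *ℤ stλ (lam H) α                   ≡⟨ cong (_*ℤ stλ (lam H) α) (sym (sgn-self H)) ⟩
  sgn H H *ℤ stλ (lam H) α                 ≡⟨ sym (+-identityʳ-ℤ _) ⟩
  signedSum H (leaves (leaf {H = H} noInternal)) α ∎
  where open ≡-Reasoning
X-expansion H (node u v (uv , du , dv) t₁ t₂ t₃) α = begin
  X H α
    ≡⟨ deletion-contraction α ⟩
  X H∖e α +ℤ (X (⊙ true) α -ℤ X (⊙ false) α)
    ≡⟨ cong₂ (λ a b → a +ℤ b) (X-expansion _ t₁ α)
             (cong₂ (λ a b → a -ℤ b) (X-expansion _ t₂ α) (X-expansion _ t₃ α)) ⟩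
  signedSum H∖e (leaves t₁) α +ℤ (signedSum (⊙ true) (leaves t₂) α -ℤ signedSum (⊙ false) (leaves t₃) α)
    ≡⟨ cong₂ (λ a b → a +ℤ b) (re-sign t₁ iota-∖) (cong₂ (λ a b → a -ℤ b) (re-sign t₂ iota-⊙) flip-sign) ⟩
  F₁ +ℤ (F₂ -ℤ ℤ.- F₃)
    ≡⟨ cong (λ z → F₁ +ℤ (F₂ +ℤ z)) (neg-involutive F₃) ⟩
  F₁ +ℤ (F₂ +ℤ F₃)
    ≡⟨ sym (trans (sumℤ-++ term (leaves t₁) _) (cong (F₁ +ℤ_) (sumℤ-++ term (leaves t₂) (leaves t₃)))) ⟩
  signedSum H (leaves t₁ ++ leaves t₂ ++ leaves t₃) α ∎
  where
  open ≡-Reasoning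
  open Contraction H u v uv
  open ExpansionStep H u v uv du dv
  term : Graph _ → ℤ
  term L = sgn H L *ℤ stλ (lam L) α
  F₁ F₂ F₃ : ℤ
  F₁ = signedSum H (leaves t₁) α
  F₂ = signedSum H (leaves t₂) α
  F₃ = signedSum H (leaves t₃) α
  re-sign : ∀ {K} (t : ExpTree K) → iota K ≡ iota H → signedSum K (leaves t) α ≡ signedSum H (leaves t) α
  re-sign {K} t e = sumℤ-map-cong (leaves t) (λ L → cong (_*ℤ stλ (lam L) α) (sgn-cong {H = H} {K} L e))
  flip-sign : signedSum (⊙ false) (leaves t₃) α ≡ ℤ.- F₃
  flip-sign = trans (sumℤ-map-cong (leaves t₃) (λ L →
                trans (cong (_*ℤ stλ (lam L) α) (sgn-suc {H = H} {⊙ false} L iota-⊙⁻)) (sym (neg-distribˡ-* (sgn H L) _))))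
              (sumℤ-neg (leaves t₃) term)

theorem3p4 : ∀ {n : ℕ} (G : Graph n) (T : ExpTree G) →
    All IsStarForest (leaves T) ×
    (∀ (α : List ℕ) → X G α ≡ sumℤ (map (λ H → sgn G H *ℤ stλ (lam H) α) (leaves T))) ×
    (∀ H H′ → H ∈ leaves T → H′ ∈ leaves T → lam H ↭ lam H′ → sgn G H ≡ sgn G H′)
theorem3p4 G T = All.map (λ {H} noInternal → WithoutInternalEdges.isStarForest H noInternal) (leaves-noInternal T)
               , X-expansion G T
               , same-sign
  where
  same-sign : ∀ H H′ → H ∈ leaves T → H′ ∈ leaves T → lam H ↭ lam H′ → sgn G H ≡ sgn G H′
  same-sign H H′ H∈ H′∈ p = cong (λ i → negOnePow (ℤ.+ i -ℤ ℤ.+ iota G)) (begin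
    iota H                          ≡⟨ Leaf.iota≡singletons H (All.lookup (leaves-noInternal T) H∈) ⟩
    countIn (λ k → k ≡ᵇ 1) (lam H)  ≡⟨ countIn-↭ (λ k → k ≡ᵇ 1) p ⟩
    countIn (λ k → k ≡ᵇ 1) (lam H′) ≡⟨ sym (Leaf.iota≡singletons H′ (All.lookup (leaves-noInternal T) H′∈)) ⟩
    iota H′                         ∎)
    where open ≡-Reasoning
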